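{- Let $\beta=[1]\in\mathsf{CycEq}(\mathsf{P}_1)$ and let $F$ be the free right $\mathsf{PlanEq}$-module on one generator $b$ in component $\mathsf{P}_1$. Then the morphism of right $\mathsf{PlanEq}$-modules $F\to\mathsf{CycEq}$ with $b\mapsto\beta$ is surjective, and its kernel is the right submodule generated by $b\circ^{\mathsf{P}_2}_{\{1,2\}}\mu-b\circ^{\mathsf{P}_2}_{\{1,2\}}\mu^{(12)}$, where $\mu=(1,2)$, $\mu^{(12)}=(2,1)\in\mathsf{PlanEq}(\mathsf{P}_2)$. That is, $\mathsf{CycEq}$ is generated by $\beta$ subject to $\beta\circ^{\mathsf{P}_2}_{\{1,2\}}\mu=\beta\circ^{\mathsf{P}_2}_{\{1,2\}}\mu^{(12)}$.
   Context: Graphs are finite, simple, undirected; a tube is a nonempty vertex set inducing a connected subgraph; $\Gamma/G$ contracts the tube $G$ to a vertex $\{G\}$; $\mathsf{P}_n$ is the path on $\{1,\dots,n\}$. Contractads (over a field $\mathsf{k}$) and right modules: families of vector spaces over nonempty connected graphs, functorial in isomorphisms, with equivariant, unital, associative compositions $\circ^\Gamma_G:\mathcal{P}(\Gamma/G)\otimes\mathcal{P}(\Gamma|_G)\to\mathcal{P}(\Gamma)$, resp. actions $\mathcal{M}(\Gamma/G)\otimes\mathcal{P}(\Gamma|_G)\to\mathcal{M}(\Gamma)$, for tubes $G$; the free right module on $\mathcal{V}$ is $\bigoplus_I\mathcal{V}(\Gamma/I)\otimes\bigotimes_{G\in I}\mathcal{P}(\Gamma|_G)$ over partitions $I$ of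 $V_\Gamma$ into tubes. A $\Gamma$-admissible planar binary tree is a planar rooted tree, internal vertices with two children, leaves labelled bijectively by $V_\Gamma$, the leaf set below each vertex being a tube. $\mathsf{PlanEq}(\Gamma)$ has basis the orderings $(v_1,\dots,v_n)$ of $V_\Gamma$ that are left-to-right leaf sequences of such trees, with contractad structure by substitution of a sequence of $\Gamma|_G$ in place of $\{G\}$. $\mathsf{CycEq}(\Gamma)$ has basis the cyclic orderings $[v_1,\dots,v_n]$ (orderings modulo rotation) having a representative in $\mathsf{PlanEq}(\Gamma)$; the right $\mathsf{PlanEq}$-action substitutes a sequence $(w_1,\dots,w_m)\in\mathsf{PlanEq}(\Gamma|_G)$ for $\{G\}$ in a cyclic ordering of $\Gamma/G$ (equivalently grafting of planar trees). -}

module Defs where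

open import Level using (Level; _⊔_) renaming (suc to lsuc; zero to lzero)
open import Algebra.Bundles using (CommutativeRing)
open import Data.Bool using (Bool; true; false)
open import Data.Empty using (⊥)
open import Data.Unit using (⊤; tt)
open import Data.Nat using (ℕ; zero; suc)
open import Data.Nat.Properties using (1+n≢n)
open import Data.Fin using (Fin; toℕ)
import Data.Fin.Properties as FinP
open import Data.Product using (Σ; _×_; _,_; proj₁; proj₂)
open import Data.Sum using (_⊎_; inj₁; inj₂)
open import Data.List using (List; []; _∷_; _++_; map; concatMap; take; drop; length; upTo)
import Data.List.Properties as ListP
open import Data.List.Membership.Propositional using (_∈_)
import Data.List.Membership.DecPropositional as DecMem
open import Data.List.Relation.Unary.Unique.Propositional using (Unique)
open import Data.List.Relation.Unary.All using (All)
open import Relation.Binary.PropositionalEquality using (_≡_; refl; sym; trans; cong)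
open import Relation.Nullary using (¬_; Dec; yes; no)
open import Relation.Binary.Definitions using (DecidableEquality)
open import Function.Bundles using (_↔_; Inverse; _⇔_)

record Field (c ℓ : Level) : Set (lsuc (c ⊔ ℓ)) where
  field
    commutativeRing : CommutativeRing c ℓ
  open CommutativeRing commutativeRing public
  field
    1≉0     : ¬ (1# ≈ 0#)
    inverse : ∀ x → ¬ (x ≈ 0#) → Σ Carrier λ y → (x * y) ≈ 1#

-- Simple undirected graphs (vertex type arbitrary; finiteness is a
-- separate hypothesis, see Finite)

record Graph : Set₁ where
  field
    V          : Set
    Adj        : V → V → Set
    Adj-sym    : ∀ {u v} → Adj u v → Adj v u
    Adj-irrefl : ∀ {v} → ¬ Adj v v
open Graph public

Finite : Graph → Set
Finite Γ = Σ ℕ λ n → Fin n ↔ V Γ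

finDecEq : (Γ : Graph) → Finite Γ → DecidableEquality (V Γ)
finDecEq Γ (n , e) u w with Inverse.from e u FinP.≟ Inverse.from e w
... | yes p = yes (trans (sym (Inverse.strictlyInverseˡ e u))
                   (trans (cong (Inverse.to e) p) (Inverse.strictlyInverseˡ e w)))
... | no ¬p = no (λ q → ¬p (cong (Inverse.from e) q))

record Iso (Γ Δ : Graph) : Set where
  field
    bij : V Γ ↔ V Δ
    adj : ∀ u w → Adj Γ u w ⇔ Adj Δ (Inverse.to bij u) (Inverse.to bij w)

data PathIn (Γ : Graph) (P : V Γ → Set) : V Γ → V Γ → Set where
  here : ∀ {v} → P v → PathIn Γ P v v
  step : ∀ {u w v} → P u → Adj Γ u w → PathIn Γ P w v → PathIn Γ P u v

IsTubeP : (Γ : Graph) → (V Γ → Set) → Set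
IsTubeP Γ P = Σ (V Γ) P × (∀ u v → P u → P v → PathIn Γ P u v)

-- subsets of vertices are Bool-valued
IsTube : (Γ : Graph) → (V Γ → Bool) → Set
IsTube Γ G = IsTubeP Γ (λ v → G v ≡ true)

Connected : Graph → Set
Connected Γ = IsTubeP Γ (λ _ → ⊤)

-- the path graph P_n on Fin n (vertex i ↔ i+1 of the paper)
PathGraph : ℕ → Graph
PathGraph n = record
  { V = Fin n
  ; Adj = λ i j → (suc (toℕ i) ≡ toℕ j) ⊎ (suc (toℕ j) ≡ toℕ i)
  ; Adj-sym = λ { (inj₁ p) → inj₂ p ; (inj₂ p) → inj₁ p }
  ; Adj-irrefl = λ { (inj₁ p) → 1+n≢n p ; (inj₂ p) → 1+n≢n p }
  }

restrict : (Γ : Graph) → (V Γ → Bool) → Graph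
restrict Γ G = record
  { V = Σ (V Γ) (λ v → G v ≡ true)
  ; Adj = λ u w → Adj Γ (proj₁ u) (proj₁ w)
  ; Adj-sym = Adj-sym Γ
  ; Adj-irrefl = Adj-irrefl Γ
  }

-- contraction Γ/G: vertices outside G, plus the new vertex {G} (= inj₂ tt)
module _ (Γ : Graph) (G : V Γ → Bool) where
  CV : Set
  CV = Σ (V Γ) (λ v → G v ≡ false) ⊎ ⊤

  CAdj : CV → CV → Set
  CAdj (inj₁ u) (inj₁ w) = Adj Γ (proj₁ u) (proj₁ w)
  CAdj (inj₁ u) (inj₂ _) = Σ (V Γ) λ w → (G w ≡ true) × Adj Γ (proj₁ u) w
  CAdj (inj₂ _) (inj₁ u) = Σ (V Γ) λ w → (G w ≡ true) × Adj Γ w (proj₁ u)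
  CAdj (inj₂ _) (inj₂ _) = ⊥

  CAdj-sym : ∀ {u v} → CAdj u v → CAdj v u
  CAdj-sym {inj₁ u} {inj₁ w} a = Adj-sym Γ a
  CAdj-sym {inj₁ u} {inj₂ _} (w , g , a) = w , g , Adj-sym Γ a
  CAdj-sym {inj₂ _} {inj₁ u} (w , g , a) = w , g , Adj-sym Γ a
  CAdj-sym {inj₂ _} {inj₂ _} ()

  CAdj-irrefl : ∀ {v} → ¬ CAdj v v
  CAdj-irrefl {inj₁ u} a = Adj-irrefl Γ a
  CAdj-irrefl {inj₂ _} ()

contract : (Γ : Graph) → (V Γ → Bool) → Graph
contract Γ G = record
  { V = CV Γ G ; Adj = CAdj Γ G ; Adj-sym = λ {u} {v} → CAdj-sym Γ G {u} {v}
  ; Adj-irrefl = λ {v} → CAdj-irrefl Γ G {v} }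

data Tree (A : Set) : Set where
  leaf : A → Tree A
  node : Tree A → Tree A → Tree A

leaves : ∀ {A : Set} → Tree A → List A
leaves (leaf a)   = a ∷ []
leaves (node l r) = leaves l ++ leaves r

IsOrdering : (Γ : Graph) → List (V Γ) → Set
IsOrdering Γ l = Unique l × (∀ v → v ∈ l)

AllTubes : (Γ : Graph) → Tree (V Γ) → Set
AllTubes Γ (leaf v)   = IsTubeP Γ (λ w → w ∈ leaves (leaf v))
AllTubes Γ (node l r) =
  IsTubeP Γ (λ w → w ∈ leaves (node l r)) × AllTubes Γ l × AllTubes Γ r

Admissible : (Γ : Graph) → Tree (V Γ) → Set
Admissible Γ t = IsOrdering Γ (leaves t) × AllTubes Γ t

-- basis elements of PlanEq(Γ)
PlanEq : (Γ : Graph) → List (V Γ) → Set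
PlanEq Γ l = Σ (Tree (V Γ)) λ t → Admissible Γ t × (leaves t ≡ l)

rot : ∀ {A : Set} → ℕ → List A → List A
rot i l = drop i l ++ take i l

Rotation : ∀ {A : Set} → List A → List A → Set
Rotation l l' = Σ ℕ λ i → l' ≡ rot i l

-- the cyclic ordering [l] is a basis element of CycEq(Γ)
CycEq : (Γ : Graph) → List (V Γ) → Set
CycEq Γ l = Σ (List (V Γ)) λ l' → Rotation l l' × PlanEq Γ l'

substOrd : (Γ : Graph) (G : V Γ → Bool) →
           List (V (contract Γ G)) → List (V (restrict Γ G)) → List (V Γ)
substOrd Γ G []                  p = []
substOrd Γ G (inj₁ (v , _) ∷ l)  p = v ∷ substOrd Γ G l p
substOrd Γ G (inj₂ _ ∷ l)        p = map proj₁ p ++ substOrd Γ G l p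

-- Linear algebra with formal linear combinations over a field K.
-- An element of k[X] is a finite formal sum, i.e. a list of
-- (coefficient , basis element) pairs.

module _ {c ℓ : Level} (K : Field c ℓ) where
  open Field K

  FS : Graph → Set c
  FS Γ = List (Carrier × List (V Γ))

  -- x is an element of F(Γ) ≅ k PlanEq(Γ)   (F(Γ) has basis b ∘ ω, ω ∈ PlanEq(Γ))
  InF : (Γ : Graph) → FS Γ → Set c
  InF Γ x = All (λ e → PlanEq Γ (proj₂ e)) x

  -- y is an element of k CycEq(Γ), written with representatives of cyclic orderings
  InCyc : (Γ : Graph) → FS Γ → Set c
  InCyc Γ y = All (λ e → CycEq Γ (proj₂ e)) y

  scaleFS : ∀ {Γ} → Carrier → FS Γ → FS Γ
  scaleFS a x = map (λ e → (a * proj₁ e) , proj₂ e) x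

  -- right PlanEq-action on F:  (b∘ω) ∘_G p = b∘(ω ∘_G p)
  actFS : (Γ : Graph) (G : V Γ → Bool) → FS (contract Γ G) → List (V (restrict Γ G)) → FS Γ
  actFS Γ G x p = map (λ e → proj₁ e , substOrd Γ G (proj₂ e) p) x

  relabelFS : ∀ {Γ Δ} → Iso Γ Δ → FS Γ → FS Δ
  relabelFS φ x = map (λ e → proj₁ e , map (Inverse.to (Iso.bij φ)) (proj₂ e)) x

  combine : ∀ {Γ} → List (Carrier × FS Γ) → FS Γ
  combine {Γ} gs = concatMap (λ e → scaleFS {Γ} (proj₁ e) (proj₂ e)) gs

  relation : FS (PathGraph 2)
  relation = (1# , (Fin.zero ∷ Fin.suc Fin.zero ∷ [])) ∷ ((- 1#) , (Fin.suc Fin.zero ∷ Fin.zero ∷ [])) ∷ []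

  data Gen : (Γ : Graph) → FS Γ → Set (lsuc lzero ⊔ c) where
    gen-r   : Gen (PathGraph 2) relation
    gen-iso : ∀ {Γ Δ} (φ : Iso Γ Δ) {x} → Gen Γ x → Gen Δ (relabelFS φ x)
    gen-act : ∀ {Γ} (G : V Γ → Bool) → IsTube Γ G →
              ∀ {x} → Gen (contract Γ G) x →
              ∀ (p : List (V (restrict Γ G))) → PlanEq (restrict Γ G) p →
              Gen Γ (actFS Γ G x p)

  module Coeffs (Γ : Graph) (_≟_ : DecidableEquality (V Γ)) where
    open DecMem (ListP.≡-dec _≟_) using (_∈?_)

    coeff : FS Γ → List (V Γ) → Carrier
    coeff []            w = 0#
    coeff ((a , l) ∷ x) w with ListP.≡-dec _≟_ l w
    ... | yes _ = a + coeff x w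
    ... | no  _ = coeff x w

    rotations : List (V Γ) → List (List (V Γ))
    rotations w = map (λ i → rot i w) (upTo (suc (length w)))

    -- coefficient of the cyclic ordering [w] in the image of x in k CycEq(Γ)
    -- (this is the linear map F → CycEq,  b ∘ ω ↦ β ∘ ω = [ω])
    cycCoeff : FS Γ → List (V Γ) → Carrier
    cycCoeff []            w = 0#
    cycCoeff ((a , l) ∷ x) w with l ∈? rotations w
    ... | yes _ = a + cycCoeff x w
    ... | no  _ = cycCoeff x w

    _≈F_ : FS Γ → FS Γ → Set ℓ
    x ≈F y = ∀ w → coeff x w ≈ coeff y w

    InKernel : FS Γ → Set ℓ
    InKernel x = ∀ w → cycCoeff x w ≈ 0#

    InSubmodule : FS Γ → Set (lsuc lzero ⊔ c ⊔ ℓ)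
    InSubmodule x = Σ (List (Carrier × FS Γ)) λ gs →
      All (λ e → Gen Γ (proj₂ e)) gs × (x ≈F combine {Γ} gs)

    Surjective : Set (c ⊔ ℓ)
    Surjective = ∀ y → InCyc Γ y →
      Σ (FS Γ) λ x → InF Γ x × (∀ w → cycCoeff x w ≈ cycCoeff y w)

-- Every generator of the submodule is ω − ω′ with ω′ a rotation of ω, so the submodule lies in
-- the kernel, and every cyclic ordering has a planar representative, so the map is onto.
-- Conversely, two planar orderings that are rotations of each other are joined by a chain of
-- moves ω ↦ ω′ along generators. By induction on the number of vertices: a cherry u v of the
-- tree of the target is an edge; if u v is consecutive in both orderings, contract {u,v},
-- rotate in Γ/{u,v} and substitute (u,v) back; otherwise first swap the two subtrees of the
-- root of the source, which is reduced to a contraction in the same way. Modulo the submodule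
-- an element of F therefore becomes one multiple of a representative per cyclic class, whose
-- coefficient is the image coefficient, hence zero on the kernel.

module Submission where

open import Defs
open import Level using (Level; _⊔_) renaming (suc to lsuc; zero to lzero)
open import Axiom.UniquenessOfIdentityProofs using (module Decidable⇒UIP)
open import Data.Empty using (⊥; ⊥-elim)
open import Data.Unit using (tt)
import Data.Unit.Properties as Unit
open import Data.Bool using (Bool; true; false)
import Data.Bool.Properties as Bool
open import Data.Nat using (ℕ; zero; suc; _≤_; z≤n; s≤s)
open import Data.Nat.Properties using (suc-injective; m≤n⇒m≤1+n; ≤-trans; ≤-refl)
open import Data.Fin using (Fin) renaming (zero to fzero; suc to fsuc)
open import Data.Product using (Σ; ∃; ∃₂; _×_; _,_; proj₁; proj₂)
import Data.Product.Properties as Product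
open import Data.Sum using (_⊎_; inj₁; inj₂)
import Data.Sum.Properties as Sum
open import Data.List using (List; []; _∷_; _++_; map; length; take; drop; upTo; deduplicate)
open import Data.List.Properties
  using (≡-dec; ∷-injective; ++-assoc; ++-identityʳ; ++-conicalˡ; ++-conicalʳ; map-++; concatMap-++;
         length-map; length-++-comm; length-++-≤ˡ; take++drop≡id)
open import Data.List.Membership.Propositional using (_∈_; _∉_)
open import Data.List.Membership.Propositional.Properties
  using (∈-++⁺ˡ; ∈-++⁺ʳ; ∈-++⁻; ∈-map⁺; ∈-map⁻; ∈-upTo⁺; ∈-deduplicate⁺; ∈-deduplicate⁻)
import Data.List.Membership.DecPropositional as DecMembership
open import Data.List.Relation.Unary.Any using (here; there)
import Data.List.Relation.Unary.Any.Properties as Any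
open import Data.List.Relation.Unary.All using (All; []; _∷_)
import Data.List.Relation.Unary.All as All
import Data.List.Relation.Unary.All.Properties as All
open import Data.List.Relation.Unary.AllPairs using ([]; _∷_)
open import Data.List.Relation.Unary.Unique.Propositional using (Unique)
import Data.List.Relation.Unary.Unique.Propositional.Properties as Unique
import Data.List.Relation.Unary.Unique.DecPropositional.Properties as DecUnique
open import Function.Base using (_∘_)
open import Function.Bundles using (_⇔_; mk⇔; mk↔ₛ′; Inverse)
open import Relation.Binary.Definitions using (DecidableEquality)
open import Relation.Binary.PropositionalEquality
  using (_≡_; _≢_; refl; sym; trans; cong; cong₂; subst; subst₂; module ≡-Reasoning)
open import Relation.Binary.Construct.Closure.ReflexiveTransitive using (Star; ε; _◅_; _◅◅_; gmap)
open import Relation.Nullary using (¬_; yes; no; Dec)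
open import Relation.Nullary.Decidable using (map′)

module _ {A : Set} where

  ++-split : (as bs cs ds : List A) → as ++ bs ≡ cs ++ ds →
    (∃ λ zs → cs ≡ as ++ zs × bs ≡ zs ++ ds) ⊎ (∃ λ zs → as ≡ cs ++ zs × ds ≡ zs ++ bs)
  ++-split []       bs cs       ds eq = inj₁ (cs , refl , eq)
  ++-split (a ∷ as) bs []       ds eq = inj₂ (a ∷ as , refl , sym eq)
  ++-split (a ∷ as) bs (c ∷ cs) ds eq with ∷-injective eq
  ... | refl , eq′ with ++-split as bs cs ds eq′
  ... | inj₁ (zs , e₁ , e₂) = inj₁ (zs , cong (a ∷_) e₁ , e₂)
  ... | inj₂ (zs , e₁ , e₂) = inj₂ (zs , cong (a ∷_) e₁ , e₂)

  data PairPosition (ls rs ps qs : List A) (x y : A) : Set where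
    inLeft   : ∀ qs₁ → ls ≡ ps ++ x ∷ y ∷ qs₁ → PairPosition ls rs ps qs x y
    inRight  : ∀ ps₁ → rs ≡ ps₁ ++ x ∷ y ∷ qs → PairPosition ls rs ps qs x y
    straddle : ls ≡ ps ++ x ∷ [] → rs ≡ y ∷ qs → PairPosition ls rs ps qs x y

  pairPosition : ∀ ls rs ps qs x y → ls ++ rs ≡ ps ++ x ∷ y ∷ qs → PairPosition ls rs ps qs x y
  pairPosition ls rs ps qs x y eq with ++-split ls rs ps (x ∷ y ∷ qs) eq
  ... | inj₁ (zs , _ , e) = inRight zs e
  ... | inj₂ ([] , _ , e) = inRight [] (sym e)
  ... | inj₂ (_ ∷ [] , e₁ , e₂) with ∷-injective e₂
  ... | refl , e₃ = straddle e₁ (sym e₃)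
  pairPosition ls rs ps qs x y eq | inj₂ (_ ∷ _ ∷ zs , e₁ , e₂) with ∷-injective e₂
  ... | refl , e₃ with ∷-injective e₃
  ... | refl , _ = inLeft zs e₁

  ++-head : ∀ (xs ys : List A) {y zs} → xs ≢ [] → xs ++ ys ≡ y ∷ zs → ∃ λ xs′ → xs ≡ y ∷ xs′
  ++-head []       ys xs≢[] _  = ⊥-elim (xs≢[] refl)
  ++-head (x ∷ xs) ys _     eq with ∷-injective eq
  ... | refl , _ = xs , refl

  ++-last : ∀ (xs ys : List A) {y} zs → ys ≢ [] → xs ++ ys ≡ zs ++ y ∷ [] → ∃ λ ys′ → ys ≡ ys′ ++ y ∷ []
  ++-last xs ys zs ys≢[] eq with ++-split xs ys zs _ eq
  ... | inj₁ (ws , _ , e) = ws , e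
  ... | inj₂ ([] , _ , e) = [] , sym e
  ... | inj₂ (_ ∷ ws , _ , e) = ⊥-elim (ys≢[] (++-conicalʳ ws ys (sym (proj₂ (∷-injective e)))))

  [x]≡xs++[y]⇒x≡y : ∀ {x y : A} xs → x ∷ [] ≡ xs ++ y ∷ [] → x ≡ y
  [x]≡xs++[y]⇒x≡y []          eq = proj₁ (∷-injective eq)
  [x]≡xs++[y]⇒x≡y (_ ∷ [])    ()
  [x]≡xs++[y]⇒x≡y (_ ∷ _ ∷ _) ()

  [x]≢xs++y∷z∷zs : ∀ {x y z : A} xs zs → x ∷ [] ≢ xs ++ y ∷ z ∷ zs
  [x]≢xs++y∷z∷zs []      _ ()
  [x]≢xs++y∷z∷zs (_ ∷ []) _ ()
  [x]≢xs++y∷z∷zs (_ ∷ _ ∷ _) _ ()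

  Unique-++⁻ˡ : ∀ xs {ys : List A} → Unique (xs ++ ys) → Unique xs
  Unique-++⁻ˡ []       _          = []
  Unique-++⁻ˡ (x ∷ xs) (x∉ ∷ u) = All.++⁻ˡ xs x∉ ∷ Unique-++⁻ˡ xs u

  Unique-++⁻ʳ : ∀ xs {ys : List A} → Unique (xs ++ ys) → Unique ys
  Unique-++⁻ʳ []       u       = u
  Unique-++⁻ʳ (x ∷ xs) (_ ∷ u) = Unique-++⁻ʳ xs u

  Unique-++-disjoint : ∀ xs {ys : List A} → Unique (xs ++ ys) → ∀ {v} → v ∈ xs → v ∈ ys → ⊥
  Unique-++-disjoint (x ∷ xs) (x∉ ∷ u) (here refl) v∈ys = All.lookup (All.++⁻ʳ xs x∉) v∈ys refl
  Unique-++-disjoint (x ∷ xs) (_ ∷ u)  (there v∈xs) v∈ys = Unique-++-disjoint xs u v∈xs v∈ys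

  Unique-++-comm : ∀ xs {ys : List A} → Unique (xs ++ ys) → Unique (ys ++ xs)
  Unique-++-comm xs u = Unique.++⁺ (Unique-++⁻ʳ xs u) (Unique-++⁻ˡ xs u)
    (λ (v∈ys , v∈xs) → Unique-++-disjoint xs u v∈xs v∈ys)

  infix 4 _⟲_
  _⟲_ : List A → List A → Set
  xs ⟲ ys = ∃₂ λ as bs → xs ≡ as ++ bs × ys ≡ bs ++ as

  ⟲-refl : ∀ xs → xs ⟲ xs
  ⟲-refl xs = [] , xs , refl , sym (++-identityʳ xs)

  ⟲-sym : ∀ {xs ys} → xs ⟲ ys → ys ⟲ xs
  ⟲-sym (as , bs , e₁ , e₂) = bs , as , e₂ , e₁

  ⟲-trans : ∀ {xs ys zs} → xs ⟲ ys → ys ⟲ zs → xs ⟲ zs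
  ⟲-trans (as , bs , refl , refl) (cs , ds , e , refl) with ++-split bs as cs ds e
  ... | inj₁ (ws , refl , refl) = ws , ds ++ bs , ++-assoc ws ds bs , sym (++-assoc ds bs ws)
  ... | inj₂ (ws , refl , refl) = as ++ cs , ws , sym (++-assoc as cs ws) , ++-assoc ws as cs

mapTree : ∀ {A B : Set} → (A → B) → Tree A → Tree B
mapTree h (leaf x)   = leaf (h x)
mapTree h (node l r) = node (mapTree h l) (mapTree h r)

leaves-mapTree : ∀ {A B : Set} (h : A → B) t → leaves (mapTree h t) ≡ map h (leaves t)
leaves-mapTree h (leaf x)   = refl
leaves-mapTree h (node l r) =
  trans (cong₂ _++_ (leaves-mapTree h l) (leaves-mapTree h r)) (sym (map-++ h (leaves l) (leaves r)))

module _ (Γ : Graph) where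

  PathIn-mono : ∀ {P Q : V Γ → Set} → (∀ {w} → P w → Q w) → ∀ {a b} → PathIn Γ P a b → PathIn Γ Q a b
  PathIn-mono P⇒Q (here p)        = here (P⇒Q p)
  PathIn-mono P⇒Q (step p a path) = step (P⇒Q p) a (PathIn-mono P⇒Q path)

  PathIn-join : ∀ {P : V Γ → Set} {a b c d} → PathIn Γ P a b → Adj Γ b c → PathIn Γ P c d → PathIn Γ P a d
  PathIn-join (here p)        b~c rest = step p b~c rest
  PathIn-join (step p a path) b~c rest = step p a (PathIn-join path b~c rest)

  IsTubeP-resp : ∀ {P Q : V Γ → Set} → (∀ {w} → P w → Q w) → (∀ {w} → Q w → P w) → IsTubeP Γ P → IsTubeP Γ Q
  IsTubeP-resp P⇒Q Q⇒P ((a , pa) , path) = (a , P⇒Q pa) , λ x y qx qy → PathIn-mono P⇒Q (path x y (Q⇒P qx) (Q⇒P qy))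

  IsTubeP-[_] : ∀ x → IsTubeP Γ (_∈ x ∷ [])
  IsTubeP-[ x ] = (x , here refl) , λ { _ _ (here refl) (here refl) → here (here refl) }

  IsTubeP-++ : ∀ (ls rs : List (V Γ)) → IsTubeP Γ (_∈ ls) → IsTubeP Γ (_∈ rs) →
               ∀ {a b} → a ∈ ls → b ∈ rs → Adj Γ a b → IsTubeP Γ (_∈ ls ++ rs)
  IsTubeP-++ ls rs (_ , pathˡ) (_ , pathʳ) {a} {b} a∈ls b∈rs a~b = (a , ∈-++⁺ˡ a∈ls) , path
    where
    inl : ∀ {w} → w ∈ ls → w ∈ ls ++ rs
    inl = ∈-++⁺ˡ
    inr : ∀ {w} → w ∈ rs → w ∈ ls ++ rs
    inr = ∈-++⁺ʳ ls
    path : ∀ x y → x ∈ ls ++ rs → y ∈ ls ++ rs → PathIn Γ (_∈ ls ++ rs) x y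
    path x y x∈ y∈ with ∈-++⁻ ls x∈ | ∈-++⁻ ls y∈
    ... | inj₁ x∈ls | inj₁ y∈ls = PathIn-mono inl (pathˡ x y x∈ls y∈ls)
    ... | inj₂ x∈rs | inj₂ y∈rs = PathIn-mono inr (pathʳ x y x∈rs y∈rs)
    ... | inj₁ x∈ls | inj₂ y∈rs =
      PathIn-join (PathIn-mono inl (pathˡ x a x∈ls a∈ls)) a~b (PathIn-mono inr (pathʳ b y b∈rs y∈rs))
    ... | inj₂ x∈rs | inj₁ y∈ls =
      PathIn-join (PathIn-mono inr (pathʳ x b x∈rs b∈rs)) (Adj-sym Γ a~b) (PathIn-mono inl (pathˡ a y a∈ls y∈ls))

  AllTubes⇒IsTubeP : ∀ t → AllTubes Γ t → IsTubeP Γ (_∈ leaves t)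
  AllTubes⇒IsTubeP (leaf x)   tubes           = tubes
  AllTubes⇒IsTubeP (node l r) (tube , _ , _) = tube

  Adj⇒≢ : ∀ {x y} → Adj Γ x y → x ≢ y
  Adj⇒≢ x~y refl = Adj-irrefl Γ x~y

  IsTubeP-pair⇒Adj : ∀ {x y} → x ≢ y → IsTubeP Γ (_∈ x ∷ y ∷ []) → Adj Γ x y
  IsTubeP-pair⇒Adj {x} {y} x≢y (_ , path) = edge (path x y (here refl) (there (here refl)))
    where
    edge : PathIn Γ (_∈ x ∷ y ∷ []) x y → Adj Γ x y
    edge (here _)                                  = ⊥-elim (x≢y refl)
    edge (step _ a (here (here refl)))             = ⊥-elim (Adj-irrefl Γ a)
    edge (step _ a (here (there (here refl))))     = a
    edge (step _ a (step (here refl) _ _))         = ⊥-elim (Adj-irrefl Γ a)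
    edge (step _ a (step (there (here refl)) _ _)) = a

  leaves≢[] : ∀ (t : Tree (V Γ)) → leaves t ≢ []
  leaves≢[] (leaf x)   ()
  leaves≢[] (node l r) eq = leaves≢[] l (++-conicalˡ (leaves l) (leaves r) eq)

  record AdjacentPair (ω : List (V Γ)) : Set where
    constructor adjacentPair
    field
      before after : List (V Γ)
      u v          : V Γ
      split        : ω ≡ before ++ u ∷ v ∷ after
      u~v          : Adj Γ u v

  -- The two leaves of a cherry are adjacent.
  adjacentPair-node : ∀ l r → AllTubes Γ (node l r) → Unique (leaves l ++ leaves r) →
                      AdjacentPair (leaves l ++ leaves r)
  adjacentPair-node (node l₁ l₂) r (_ , tubesˡ , _) u
    with adjacentPair-node l₁ l₂ tubesˡ (Unique-++⁻ˡ (leaves l₁ ++ leaves l₂) u)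
  ... | adjacentPair ps qs x y eq x~y =
    adjacentPair ps (qs ++ leaves r) x y (trans (cong (_++ leaves r) eq) (++-assoc ps (x ∷ y ∷ qs) (leaves r))) x~y
  adjacentPair-node (leaf z) (node r₁ r₂) (_ , _ , tubesʳ) u
    with adjacentPair-node r₁ r₂ tubesʳ (Unique-++⁻ʳ (z ∷ []) u)
  ... | adjacentPair ps qs x y eq x~y = adjacentPair (z ∷ ps) qs x y (cong (z ∷_) eq) x~y
  adjacentPair-node (leaf x) (leaf y) (tube , _ , _) ((x∉ ∷ []) ∷ _) =
    adjacentPair [] [] x y refl (IsTubeP-pair⇒Adj x∉ tube)

substOrd-++ : ∀ (Γ : Graph) G as bs p → substOrd Γ G (as ++ bs) p ≡ substOrd Γ G as p ++ substOrd Γ G bs p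
substOrd-++ Γ G []                 bs p = refl
substOrd-++ Γ G (inj₁ (x , _) ∷ as) bs p = cong (x ∷_) (substOrd-++ Γ G as bs p)
substOrd-++ Γ G (inj₂ _ ∷ as)       bs p =
  trans (cong (map proj₁ p ++_) (substOrd-++ Γ G as bs p)) (sym (++-assoc (map proj₁ p) _ _))

PlanEq⇒Unique : ∀ {Γ ω} → PlanEq Γ ω → Unique ω
PlanEq⇒Unique (_ , ((un , _) , _) , refl) = un

Admissible-swap : ∀ {Γ} l r → Admissible Γ (node l r) → Admissible Γ (node r l)
Admissible-swap l r ((un , all∈) , tube , tubesˡ , tubesʳ) =
  (Unique-++-comm (leaves l) un , λ z → Any.++-comm (leaves l) (leaves r) (all∈ z)) ,
  IsTubeP-resp _ (Any.++-comm (leaves l) (leaves r)) (Any.++-comm (leaves r) (leaves l)) tube , tubesʳ , tubesˡ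

module EdgeContraction (Γ : Graph) (_≟_ : DecidableEquality (V Γ)) (u v : V Γ) (u~v : Adj Γ u v) where

  u≢v : u ≢ v
  u≢v = Adj⇒≢ Γ u~v

  uv : V Γ → Bool
  uv x with x ≟ u | x ≟ v
  ... | yes _ | _     = true
  ... | no _  | yes _ = true
  ... | no _  | no _  = false

  uv-u : uv u ≡ true
  uv-u with u ≟ u
  ... | yes _  = refl
  ... | no u≢u = ⊥-elim (u≢u refl)

  uv-v : uv v ≡ true
  uv-v with v ≟ u | v ≟ v
  ... | yes _ | _      = refl
  ... | no _  | yes _  = refl
  ... | no _  | no v≢v = ⊥-elim (v≢v refl)

  uv-outside : ∀ {x} → x ≢ u → x ≢ v → uv x ≡ false
  uv-outside {x} x≢u x≢v with x ≟ u | x ≟ v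
  ... | yes x≡u | _       = ⊥-elim (x≢u x≡u)
  ... | no _    | yes x≡v = ⊥-elim (x≢v x≡v)
  ... | no _    | no _    = refl

  uv-inside : ∀ {x} → uv x ≡ true → x ≡ u ⊎ x ≡ v
  uv-inside {x} eq with x ≟ u | x ≟ v
  ... | yes x≡u | _       = inj₁ x≡u
  ... | no _    | yes x≡v = inj₂ x≡v

  Γ/uv : Graph
  Γ/uv = contract Γ uv

  ⋆ : V Γ/uv
  ⋆ = inj₂ tt

  _≟′_ : DecidableEquality (V Γ/uv)
  _≟′_ = Sum.≡-dec (Product.≡-dec _≟_ (λ p q → yes (Decidable⇒UIP.≡-irrelevant Bool._≟_ p q))) Unit._≟_

  π-by : ∀ x b → uv x ≡ b → V Γ/uv
  π-by x true  _ = ⋆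
  π-by x false e = inj₁ (x , e)

  π : V Γ → V Γ/uv
  π x = π-by x (uv x) refl

  π-by-outside : ∀ x b (r : uv x ≡ b) (e : uv x ≡ false) → π-by x b r ≡ inj₁ (x , e)
  π-by-outside x true  r e with () ← trans (sym r) e
  π-by-outside x false r e = cong (λ e′ → inj₁ (x , e′)) (Decidable⇒UIP.≡-irrelevant Bool._≟_ r e)

  π-by-inside : ∀ x b (r : uv x ≡ b) → uv x ≡ true → π-by x b r ≡ ⋆
  π-by-inside x true  r e = refl
  π-by-inside x false r e with () ← trans (sym e) r

  π-outside : ∀ x (e : uv x ≡ false) → π x ≡ inj₁ (x , e)
  π-outside x = π-by-outside x (uv x) refl

  π-inside : ∀ x → uv x ≡ true → π x ≡ ⋆
  π-inside x = π-by-inside x (uv x) refl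

  uv-dichotomy : ∀ x → uv x ≡ true ⊎ uv x ≡ false
  uv-dichotomy x with uv x
  ... | true  = inj₁ refl
  ... | false = inj₂ refl

  π-injective : ∀ {x y} → x ≢ v → y ≢ v → π x ≡ π y → x ≡ y
  π-injective {x} {y} x≢v y≢v eq with uv-dichotomy x | uv-dichotomy y
  ... | inj₁ ex | inj₁ ey with uv-inside ex | uv-inside ey
  ...   | inj₁ x≡u | inj₁ y≡u = trans x≡u (sym y≡u)
  ...   | inj₂ x≡v | _        = ⊥-elim (x≢v x≡v)
  ...   | _        | inj₂ y≡v = ⊥-elim (y≢v y≡v)
  π-injective {x} {y} x≢v y≢v eq | inj₁ ex | inj₂ ey
    with () ← trans (sym (π-inside x ex)) (trans eq (π-outside y ey))
  π-injective {x} {y} x≢v y≢v eq | inj₂ ex | inj₁ ey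
    with () ← trans (sym (π-outside x ex)) (trans eq (π-inside y ey))
  π-injective {x} {y} x≢v y≢v eq | inj₂ ex | inj₂ ey
    with refl ← trans (sym (π-outside x ex)) (trans eq (π-outside y ey)) = refl

  π-adj : ∀ {a w} → Adj Γ a w → π a ≡ π w ⊎ Adj Γ/uv (π a) (π w)
  π-adj {a} {w} a~w with uv-dichotomy a | uv-dichotomy w
  ... | inj₁ ea | inj₁ ew = inj₁ (trans (π-inside a ea) (sym (π-inside w ew)))
  ... | inj₂ ea | inj₂ ew = inj₂ (subst₂ (Adj Γ/uv) (sym (π-outside a ea)) (sym (π-outside w ew)) a~w)
  ... | inj₂ ea | inj₁ ew = inj₂ (subst₂ (Adj Γ/uv) (sym (π-outside a ea)) (sym (π-inside w ew)) (w , ew , a~w))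
  ... | inj₁ ea | inj₂ ew = inj₂ (subst₂ (Adj Γ/uv) (sym (π-inside a ea)) (sym (π-outside w ew)) (a , ea , a~w))

  PathIn-π : ∀ {P : V Γ → Set} {P′ : V Γ/uv → Set} → (∀ {x} → P x → P′ (π x)) →
             ∀ {a b} → PathIn Γ P a b → PathIn Γ/uv P′ (π a) (π b)
  PathIn-π P⇒P′ (here p) = here (P⇒P′ p)
  PathIn-π {P′ = P′} P⇒P′ {b = b} (step p a~w path) with π-adj a~w
  ... | inj₁ eq  = subst (λ z → PathIn Γ/uv P′ z (π b)) (sym eq) (PathIn-π P⇒P′ path)
  ... | inj₂ adj = step (P⇒P′ p) adj (PathIn-π P⇒P′ path)

  -- Decided via v ≟ x: a `with` on x ≟ v would also abstract that subterm of uv x, hence of π x.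
  is-v : ∀ x → Dec (x ≡ v)
  is-v x = map′ sym sym (v ≟ x)

  collapse : List (V Γ) → List (V Γ/uv)
  collapse []       = []
  collapse (x ∷ xs) with is-v x
  ... | yes _ = collapse xs
  ... | no _  = π x ∷ collapse xs

  collapse-++ : ∀ xs ys → collapse (xs ++ ys) ≡ collapse xs ++ collapse ys
  collapse-++ []       ys = refl
  collapse-++ (x ∷ xs) ys with is-v x
  ... | yes _ = collapse-++ xs ys
  ... | no _  = cong (π x ∷_) (collapse-++ xs ys)

  collapse-v∉ : ∀ xs → v ∉ xs → collapse xs ≡ map π xs
  collapse-v∉ []       _  = refl
  collapse-v∉ (x ∷ xs) v∉ with is-v x
  ... | yes refl = ⊥-elim (v∉ (here refl))
  ... | no _     = cong (π x ∷_) (collapse-v∉ xs (λ v∈ → v∉ (there v∈)))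

  collapse-u∷v∷ : ∀ xs → collapse (u ∷ v ∷ xs) ≡ ⋆ ∷ collapse xs
  collapse-u∷v∷ xs with is-v u
  ... | yes u≡v = ⊥-elim (u≢v u≡v)
  ... | no _ with is-v v
  ...   | yes _  = cong (_∷ collapse xs) (π-inside u uv-u)
  ...   | no v≢v = ⊥-elim (v≢v refl)

  ∈-collapse⁻ : ∀ {y} xs → y ∈ collapse xs → ∃ λ x → x ∈ xs × x ≢ v × π x ≡ y
  ∈-collapse⁻ (x ∷ xs) y∈ with is-v x
  ∈-collapse⁻ (x ∷ xs) y∈ | yes _ with ∈-collapse⁻ xs y∈
  ... | z , z∈ , z≢v , eq = z , there z∈ , z≢v , eq
  ∈-collapse⁻ (x ∷ xs) (here refl) | no x≢v = x , here refl , x≢v , refl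
  ∈-collapse⁻ (x ∷ xs) (there y∈)  | no x≢v with ∈-collapse⁻ xs y∈
  ... | z , z∈ , z≢v , eq = z , there z∈ , z≢v , eq

  ∈-collapse⁺ : ∀ {x} xs → x ∈ xs → x ≢ v → π x ∈ collapse xs
  ∈-collapse⁺ (y ∷ xs) x∈ x≢v with is-v y
  ∈-collapse⁺ (y ∷ xs) (here refl) x≢v | yes y≡v = ⊥-elim (x≢v y≡v)
  ∈-collapse⁺ (y ∷ xs) (there x∈)  x≢v | yes _   = ∈-collapse⁺ xs x∈ x≢v
  ∈-collapse⁺ (y ∷ xs) (here refl) x≢v | no _    = here refl
  ∈-collapse⁺ (y ∷ xs) (there x∈)  x≢v | no _    = there (∈-collapse⁺ xs x∈ x≢v)

  -- π v = π u, so the image of v is present as soon as u is.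
  ∈-collapse⁺′ : ∀ {x} xs → (v ∈ xs → u ∈ xs) → x ∈ xs → π x ∈ collapse xs
  ∈-collapse⁺′ {x} xs v⇒u x∈ with is-v x
  ... | no x≢v   = ∈-collapse⁺ xs x∈ x≢v
  ... | yes refl = subst (_∈ collapse xs) (trans (π-inside u uv-u) (sym (π-inside v uv-v)))
                     (∈-collapse⁺ xs (v⇒u x∈) u≢v)

  Unique-collapse : ∀ xs → Unique xs → Unique (collapse xs)
  Unique-collapse []       _          = []
  Unique-collapse (x ∷ xs) (x∉ ∷ uxs) with is-v x
  ... | yes _   = Unique-collapse xs uxs
  ... | no x≢v  = All.tabulate distinct ∷ Unique-collapse xs uxs
    where
    distinct : ∀ {y} → y ∈ collapse xs → π x ≢ y
    distinct y∈ eq with ∈-collapse⁻ xs y∈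
    ... | z , z∈ , z≢v , πz≡y = All.lookup x∉ z∈ (π-injective x≢v z≢v (trans eq (sym πz≡y)))

  collapse-covers : ∀ xs → (∀ x → x ∈ xs) → ∀ y → y ∈ collapse xs
  collapse-covers xs all∈ (inj₁ (x , e)) =
    subst (_∈ collapse xs) (π-outside x e) (∈-collapse⁺ xs (all∈ x) λ { refl → case (trans (sym uv-v) e) })
    where case : true ≢ false
          case ()
  collapse-covers xs all∈ (inj₂ tt) = subst (_∈ collapse xs) (π-inside u uv-u) (∈-collapse⁺ xs (all∈ u) u≢v)

  length-collapse : ∀ xs → Unique xs → v ∈ xs → suc (length (collapse xs)) ≡ length xs
  length-collapse (x ∷ xs) (x∉ ∷ uxs) v∈ with is-v x
  ... | yes refl = cong suc (trans (cong length (collapse-v∉ xs (λ v∈xs → All.lookup x∉ v∈xs refl))) (length-map π xs))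
  length-collapse (x ∷ xs) (x∉ ∷ uxs) (here refl) | no x≢v = ⊥-elim (x≢v refl)
  length-collapse (x ∷ xs) (x∉ ∷ uxs) (there v∈)  | no x≢v = cong suc (length-collapse xs uxs v∈)

  IsTubeP-collapse : ∀ S {T} → collapse S ≡ T → IsTubeP Γ (_∈ S) → (v ∈ S → u ∈ S) → IsTubeP Γ/uv (_∈ T)
  IsTubeP-collapse S refl ((a , a∈) , path) v⇒u = (π a , ∈-collapse⁺′ S v⇒u a∈) , path′
    where
    path′ : ∀ y₁ y₂ → y₁ ∈ collapse S → y₂ ∈ collapse S → PathIn Γ/uv (_∈ collapse S) y₁ y₂
    path′ y₁ y₂ y₁∈ y₂∈ with ∈-collapse⁻ S y₁∈ | ∈-collapse⁻ S y₂∈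
    ... | x₁ , x₁∈ , _ , refl | x₂ , x₂∈ , _ , refl = PathIn-π (∈-collapse⁺′ S v⇒u) (path x₁ x₂ x₁∈ x₂∈)

  collapse-leaves : ∀ t → v ∉ leaves t → collapse (leaves t) ≡ leaves (mapTree π t)
  collapse-leaves t v∉ = trans (collapse-v∉ (leaves t) v∉) (sym (leaves-mapTree π t))

  AllTubes-mapTree-π : ∀ t → AllTubes Γ t → v ∉ leaves t → AllTubes Γ/uv (mapTree π t)
  AllTubes-mapTree-π (leaf x) tube v∉ =
    IsTubeP-collapse (x ∷ []) (collapse-leaves (leaf x) v∉) tube (⊥-elim ∘ v∉)
  AllTubes-mapTree-π (node l r) (tube , tubesˡ , tubesʳ) v∉ =
    IsTubeP-collapse (leaves (node l r)) (collapse-leaves (node l r) v∉) tube (⊥-elim ∘ v∉) ,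
    AllTubes-mapTree-π l tubesˡ (λ v∈ → v∉ (∈-++⁺ˡ v∈)) ,
    AllTubes-mapTree-π r tubesʳ (λ v∈ → v∉ (∈-++⁺ʳ (leaves l) v∈))

  CollapsedTree : List (V Γ) → Set
  CollapsedTree ω = Σ (Tree (V Γ/uv)) λ t → AllTubes Γ/uv t × leaves t ≡ collapse ω

  -- The case where u is the last leaf of l and v the first leaf of r: the spines
  -- leading to u and to v are merged, every other subtree is mapped along π.
  collapseTree-straddle : ∀ l r → AllTubes Γ l → AllTubes Γ r → Unique (leaves l ++ leaves r) →
    ∀ ps qs → leaves l ≡ ps ++ u ∷ [] → leaves r ≡ v ∷ qs → CollapsedTree (leaves l ++ leaves r)
  collapseTree-straddle (leaf x) (leaf y) tubeˡ tubeʳ _ ps qs eqˡ eqʳ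
    with [x]≡xs++[y]⇒x≡y ps eqˡ | ∷-injective eqʳ
  ... | refl | refl , _ =
    leaf ⋆ ,
    IsTubeP-collapse (u ∷ v ∷ []) (collapse-u∷v∷ [])
      (IsTubeP-++ Γ (u ∷ []) (v ∷ []) tubeˡ tubeʳ (here refl) (here refl) u~v) (λ _ → here refl) ,
    sym (collapse-u∷v∷ [])
  collapseTree-straddle (leaf x) (node r₁ r₂) tubeˡ (tubeʳ , tubes₁ , tubes₂) un ps qs eqˡ eqʳ
    with [x]≡xs++[y]⇒x≡y ps eqˡ
  ... | refl with ++-head (leaves r₁) (leaves r₂) (leaves≢[] Γ r₁) eqʳ
  ... | qs₁ , eq₁ with collapseTree-straddle (leaf u) r₁ tubeˡ tubes₁ (Unique-++⁻ˡ (u ∷ leaves r₁) un) [] qs₁ refl eq₁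
  ... | t₁ , tubes₁′ , eqt₁ = node t₁ (mapTree π r₂) , (IsTubeP-collapse S (sym eq) tubeS (λ _ → here refl) , tubes₁′ ,
                                AllTubes-mapTree-π r₂ tubes₂ v∉r₂) , eq
    where
    S : List (V Γ)
    S = u ∷ (leaves r₁ ++ leaves r₂)
    v∉r₂ : v ∉ leaves r₂
    v∉r₂ = Unique-++-disjoint (leaves r₁) (Unique-++⁻ʳ (u ∷ []) un) (subst (v ∈_) (sym eq₁) (here refl))
    eq : leaves t₁ ++ leaves (mapTree π r₂) ≡ collapse S
    eq = trans (cong₂ _++_ eqt₁ (sym (collapse-leaves r₂ v∉r₂))) (sym (collapse-++ (u ∷ leaves r₁) (leaves r₂)))
    tubeS : IsTubeP Γ (_∈ S)
    tubeS = IsTubeP-++ Γ (u ∷ []) (leaves (node r₁ r₂)) tubeˡ tubeʳ (here refl) (subst (v ∈_) (sym eqʳ) (here refl)) u~v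
  collapseTree-straddle (node l₁ l₂) r (tubeˡ , tubes₁ , tubes₂) tubesʳ un ps qs eqˡ eqʳ
    with ++-last (leaves l₁) (leaves l₂) ps (leaves≢[] Γ l₂) eqˡ
  ... | ps₂ , eq₂ with collapseTree-straddle l₂ r tubes₂ tubesʳ (Unique-++⁻ʳ (leaves l₁) un′) ps₂ qs eq₂ eqʳ
    where
    un′ : Unique (leaves l₁ ++ leaves l₂ ++ leaves r)
    un′ = subst Unique (++-assoc (leaves l₁) (leaves l₂) (leaves r)) un
  ... | t₂ , tubes₂′ , eqt₂ = node (mapTree π l₁) t₂ , (IsTubeP-collapse S (sym eq) tubeS (λ _ → ∈-++⁺ˡ u∈l) ,
                                AllTubes-mapTree-π l₁ tubes₁ v∉l₁ , tubes₂′) , eq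
    where
    S : List (V Γ)
    S = (leaves l₁ ++ leaves l₂) ++ leaves r
    v∈r : v ∈ leaves r
    v∈r = subst (v ∈_) (sym eqʳ) (here refl)
    v∉l₁ : v ∉ leaves l₁
    v∉l₁ v∈ = Unique-++-disjoint (leaves l₁) (subst Unique (++-assoc (leaves l₁) (leaves l₂) (leaves r)) un)
                v∈ (∈-++⁺ʳ (leaves l₂) v∈r)
    eq : leaves (mapTree π l₁) ++ leaves t₂ ≡ collapse S
    eq = trans (cong₂ _++_ (sym (collapse-leaves l₁ v∉l₁)) eqt₂)
           (trans (sym (collapse-++ (leaves l₁) (leaves l₂ ++ leaves r)))
                  (cong collapse (sym (++-assoc (leaves l₁) (leaves l₂) (leaves r)))))
    u∈l : u ∈ leaves l₁ ++ leaves l₂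
    u∈l = subst (u ∈_) (sym eqˡ) (∈-++⁺ʳ ps (here refl))
    tubeS : IsTubeP Γ (_∈ S)
    tubeS = IsTubeP-++ Γ (leaves l₁ ++ leaves l₂) (leaves r) tubeˡ (AllTubes⇒IsTubeP Γ r tubesʳ) u∈l v∈r u~v

  collapseTree : ∀ t → AllTubes Γ t → Unique (leaves t) → ∀ ps qs → leaves t ≡ ps ++ u ∷ v ∷ qs →
                 CollapsedTree (leaves t)
  collapseTree (leaf x) _ _ ps qs eq = ⊥-elim ([x]≢xs++y∷z∷zs ps qs eq)
  collapseTree (node l r) (tube , tubesˡ , tubesʳ) un ps qs eq with pairPosition (leaves l) (leaves r) ps qs u v eq
  ... | straddle eqˡ eqʳ = collapseTree-straddle l r tubesˡ tubesʳ un ps qs eqˡ eqʳ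
  ... | inLeft qs₁ eqˡ with collapseTree l tubesˡ (Unique-++⁻ˡ (leaves l) un) ps qs₁ eqˡ
  ...   | l′ , tubesˡ′ , eql′ = node l′ (mapTree π r) ,
          (IsTubeP-collapse S (sym eq′) tube (λ _ → u∈S) , tubesˡ′ , AllTubes-mapTree-π r tubesʳ v∉r) , eq′
    where
    S : List (V Γ)
    S = leaves l ++ leaves r
    u∈S : u ∈ S
    u∈S = subst (u ∈_) (sym eq) (∈-++⁺ʳ ps (here refl))
    v∉r : v ∉ leaves r
    v∉r = Unique-++-disjoint (leaves l) un (subst (v ∈_) (sym eqˡ) (∈-++⁺ʳ ps (there (here refl))))
    eq′ : leaves l′ ++ leaves (mapTree π r) ≡ collapse S
    eq′ = trans (cong₂ _++_ eql′ (sym (collapse-leaves r v∉r))) (sym (collapse-++ (leaves l) (leaves r)))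
  collapseTree (node l r) (tube , tubesˡ , tubesʳ) un ps qs eq | inRight ps₁ eqʳ
    with collapseTree r tubesʳ (Unique-++⁻ʳ (leaves l) un) ps₁ qs eqʳ
  ... | r′ , tubesʳ′ , eqr′ = node (mapTree π l) r′ ,
          (IsTubeP-collapse S (sym eq′) tube (λ _ → u∈S) , AllTubes-mapTree-π l tubesˡ v∉l , tubesʳ′) , eq′
    where
    S : List (V Γ)
    S = leaves l ++ leaves r
    u∈S : u ∈ S
    u∈S = subst (u ∈_) (sym eq) (∈-++⁺ʳ ps (here refl))
    v∉l : v ∉ leaves l
    v∉l v∈ = Unique-++-disjoint (leaves l) un v∈ (subst (v ∈_) (sym eqʳ) (∈-++⁺ʳ ps₁ (there (here refl))))
    eq′ : leaves (mapTree π l) ++ leaves r′ ≡ collapse S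
    eq′ = trans (cong₂ _++_ (sym (collapse-leaves l v∉l)) eqr′) (sym (collapse-++ (leaves l) (leaves r)))

  PlanEq-collapse : ∀ ω → PlanEq Γ ω → ∀ ps qs → ω ≡ ps ++ u ∷ v ∷ qs → PlanEq Γ/uv (collapse ω)
  PlanEq-collapse ω (t , ((un , all∈) , tubes) , refl) ps qs eq with collapseTree t tubes un ps qs eq
  ... | t′ , tubes′ , eq′ =
    t′ , (subst (IsOrdering Γ/uv) (sym eq′) (Unique-collapse ω un , collapse-covers ω all∈) , tubes′) , eq′

  Γ|uv : Graph
  Γ|uv = restrict Γ uv

  [u,v] : List (V Γ|uv)
  [u,v] = (u , uv-u) ∷ (v , uv-v) ∷ []

  IsTube-uv : IsTube Γ uv
  IsTube-uv = (u , uv-u) , path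
    where
    path : ∀ x y → uv x ≡ true → uv y ≡ true → PathIn Γ (λ w → uv w ≡ true) x y
    path x y ex ey with uv-inside ex | uv-inside ey
    ... | inj₁ refl | inj₁ refl = here ex
    ... | inj₂ refl | inj₂ refl = here ex
    ... | inj₁ refl | inj₂ refl = step ex u~v (here ey)
    ... | inj₂ refl | inj₁ refl = step ex (Adj-sym Γ u~v) (here ey)

  PlanEq-[u,v] : PlanEq Γ|uv [u,v]
  PlanEq-[u,v] = node (leaf (u , uv-u)) (leaf (v , uv-v)) ,
    (((((λ eq → u≢v (cong proj₁ eq)) ∷ []) ∷ [] ∷ []) , all∈) ,
     (IsTubeP-++ Γ|uv ((u , uv-u) ∷ []) ((v , uv-v) ∷ []) (IsTubeP-[_] Γ|uv _) (IsTubeP-[_] Γ|uv _) (here refl) (here refl) u~v ,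
      IsTubeP-[_] Γ|uv _ , IsTubeP-[_] Γ|uv _)) ,
    refl
    where
    all∈ : ∀ (z : V Γ|uv) → z ∈ [u,v]
    all∈ (x , e) with uv-inside e
    ... | inj₁ refl = here (cong (u ,_) (Decidable⇒UIP.≡-irrelevant Bool._≟_ e uv-u))
    ... | inj₂ refl = there (here (cong (v ,_) (Decidable⇒UIP.≡-irrelevant Bool._≟_ e uv-v)))

  substOrd-map-π : ∀ xs → (∀ {x} → x ∈ xs → x ≢ u × x ≢ v) → substOrd Γ uv (map π xs) [u,v] ≡ xs
  substOrd-map-π []       _    = refl
  substOrd-map-π (x ∷ xs) ≢uv with ≢uv (here refl)
  ... | x≢u , x≢v rewrite π-outside x (uv-outside x≢u x≢v) = cong (x ∷_) (substOrd-map-π xs (≢uv ∘ there))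

  substOrd-collapse : ∀ ps qs → Unique (ps ++ u ∷ v ∷ qs) →
                      substOrd Γ uv (collapse (ps ++ u ∷ v ∷ qs)) [u,v] ≡ ps ++ u ∷ v ∷ qs
  substOrd-collapse ps qs un = begin
    substOrd Γ uv (collapse (ps ++ u ∷ v ∷ qs)) [u,v]          ≡⟨ cong (λ zs → substOrd Γ uv zs [u,v]) collapse-eq ⟩
    substOrd Γ uv (map π ps ++ ⋆ ∷ map π qs) [u,v]              ≡⟨ substOrd-++ Γ uv (map π ps) (⋆ ∷ map π qs) [u,v] ⟩
    substOrd Γ uv (map π ps) [u,v] ++ u ∷ v ∷ substOrd Γ uv (map π qs) [u,v]
                                                                 ≡⟨ cong₂ (λ as bs → as ++ u ∷ v ∷ bs) (substOrd-map-π ps ≢uvˡ)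
                                                                                                       (substOrd-map-π qs ≢uvʳ) ⟩
    ps ++ u ∷ v ∷ qs ∎
    where
    open ≡-Reasoning
    unʳ : Unique (u ∷ v ∷ qs)
    unʳ = Unique-++⁻ʳ ps un
    u∉qs : u ∉ qs
    u∉qs u∈ with unʳ
    ... | (_ ∷ u∉) ∷ _ = All.lookup u∉ u∈ refl
    v∉qs : v ∉ qs
    v∉qs v∈ with unʳ
    ... | _ ∷ v∉ ∷ _ = All.lookup v∉ v∈ refl
    ≢uvˡ : ∀ {x} → x ∈ ps → x ≢ u × x ≢ v
    ≢uvˡ x∈ = (λ { refl → Unique-++-disjoint ps un x∈ (here refl) }) ,
              (λ { refl → Unique-++-disjoint ps un x∈ (there (here refl)) })
    ≢uvʳ : ∀ {x} → x ∈ qs → x ≢ u × x ≢ v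
    ≢uvʳ x∈ = (λ { refl → u∉qs x∈ }) , (λ { refl → v∉qs x∈ })
    collapse-eq : collapse (ps ++ u ∷ v ∷ qs) ≡ map π ps ++ ⋆ ∷ map π qs
    collapse-eq = trans (collapse-++ ps (u ∷ v ∷ qs))
      (cong₂ _++_ (collapse-v∉ ps (λ v∈ → proj₂ (≢uvˡ v∈) refl))
                  (trans (collapse-u∷v∷ qs) (cong (⋆ ∷_) (collapse-v∉ qs v∉qs))))

module Moves {c ℓ : Level} (K : Field c ℓ) where
  open Field K using (1#; -_)

  Move : (Γ : Graph) → List (V Γ) → List (V Γ) → Set (lsuc lzero ⊔ c)
  Move Γ ω ω′ = Gen K Γ ((1# , ω) ∷ (- 1# , ω′) ∷ [])

  Moves : (Γ : Graph) → List (V Γ) → List (V Γ) → Set (lsuc lzero ⊔ c)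
  Moves Γ = Star (Move Γ)

  Moves-substOrd : ∀ Γ G → IsTube Γ G → ∀ p → PlanEq (restrict Γ G) p → ∀ {ω ω′} →
                   Moves (contract Γ G) ω ω′ → Moves Γ (substOrd Γ G ω p) (substOrd Γ G ω′ p)
  Moves-substOrd Γ G tube p p-plan = gmap (λ ω → substOrd Γ G ω p) (λ m → gen-act G tube m p p-plan)

  -- The relation itself, transported along P₂ ≅ Γ.
  Move-transposition : ∀ Γ (_≟_ : DecidableEquality (V Γ)) x y → (∀ z → z ∈ x ∷ y ∷ []) → Adj Γ x y →
                       Move Γ (x ∷ y ∷ []) (y ∷ x ∷ [])
  Move-transposition Γ _≟_ x y all∈ x~y = gen-iso φ gen-r
    where
    to : Fin 2 → V Γ
    to fzero        = x
    to (fsuc fzero) = y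
    from : V Γ → Fin 2
    from z with z ≟ x
    ... | yes _ = fzero
    ... | no _  = fsuc fzero
    to-from : ∀ z → to (from z) ≡ z
    to-from z with z ≟ x
    ... | yes z≡x = sym z≡x
    ... | no z≢x with all∈ z
    ...   | here z≡x         = ⊥-elim (z≢x z≡x)
    ...   | there (here z≡y) = sym z≡y
    from-to : ∀ i → from (to i) ≡ i
    from-to fzero with x ≟ x
    ... | yes _   = refl
    ... | no x≢x  = ⊥-elim (x≢x refl)
    from-to (fsuc fzero) with y ≟ x
    ... | yes y≡x = ⊥-elim (Adj⇒≢ Γ x~y (sym y≡x))
    ... | no _    = refl
    adj : ∀ i j → Adj (PathGraph 2) i j ⇔ Adj Γ (to i) (to j)
    adj fzero        fzero        = mk⇔ (λ { (inj₁ ()) ; (inj₂ ()) }) (⊥-elim ∘ Adj-irrefl Γ)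
    adj fzero        (fsuc fzero) = mk⇔ (λ _ → x~y) (λ _ → inj₁ refl)
    adj (fsuc fzero) fzero        = mk⇔ (λ _ → Adj-sym Γ x~y) (λ _ → inj₂ refl)
    adj (fsuc fzero) (fsuc fzero) = mk⇔ (λ { (inj₁ ()) ; (inj₂ ()) }) (⊥-elim ∘ Adj-irrefl Γ)
    φ : Iso (PathGraph 2) Γ
    φ = record { bij = mk↔ₛ′ to from to-from from-to ; adj = adj }

  Moves-uncollapse : ∀ Γ (_≟_ : DecidableEquality (V Γ)) {u v} (u~v : Adj Γ u v) →
    let open EdgeContraction Γ _≟_ u v u~v in
    ∀ {ω ω′} ps qs ps′ qs′ → ω ≡ ps ++ u ∷ v ∷ qs → ω′ ≡ ps′ ++ u ∷ v ∷ qs′ → Unique ω → Unique ω′ →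
    Moves Γ/uv (collapse ω) (collapse ω′) → Moves Γ ω ω′
  Moves-uncollapse Γ _≟_ {u} {v} u~v ps qs ps′ qs′ refl refl un un′ ms =
    subst₂ (Moves Γ) (substOrd-collapse ps qs un) (substOrd-collapse ps′ qs′ un′)
      (Moves-substOrd Γ uv IsTube-uv [u,v] PlanEq-[u,v] ms)
    where open EdgeContraction Γ _≟_ u v u~v

  SwapChildren : ℕ → Set (lsuc lzero ⊔ c)
  SwapChildren n = ∀ Γ (_≟_ : DecidableEquality (V Γ)) l r → Admissible Γ (node l r) →
                   length (leaves l ++ leaves r) ≡ n → Moves Γ (leaves l ++ leaves r) (leaves r ++ leaves l)

  -- Contract an adjacent pair that stays consecutive after swapping, swap in Γ/uv, and substitute back.
  swapChildren-collapse : ∀ m → SwapChildren m → ∀ Γ (_≟_ : DecidableEquality (V Γ)) l r →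
    Admissible Γ (node l r) → length (leaves l ++ leaves r) ≡ suc m → ∀ {u v} (u~v : Adj Γ u v) →
    let open EdgeContraction Γ _≟_ u v u~v in
    CollapsedTree (leaves l) → CollapsedTree (leaves r) →
    ∀ ps qs ps′ qs′ → leaves l ++ leaves r ≡ ps ++ u ∷ v ∷ qs → leaves r ++ leaves l ≡ ps′ ++ u ∷ v ∷ qs′ →
    Moves Γ (leaves l ++ leaves r) (leaves r ++ leaves l)
  swapChildren-collapse m swap Γ _≟_ l r ((un , all∈) , tube , _) len {u} {v} u~v
    (l′ , tubesˡ′ , eqˡ) (r′ , tubesʳ′ , eqʳ) ps qs ps′ qs′ eq eq′ =
    Moves-uncollapse Γ _≟_ u~v ps qs ps′ qs′ eq eq′ un (Unique-++-comm (leaves l) un)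
      (subst₂ (Moves Γ/uv) collapse-lr collapse-rl (swap Γ/uv _≟′_ l′ r′ admissible′ length′))
    where
    open EdgeContraction Γ _≟_ u v u~v
    collapse-lr : leaves l′ ++ leaves r′ ≡ collapse (leaves l ++ leaves r)
    collapse-lr = trans (cong₂ _++_ eqˡ eqʳ) (sym (collapse-++ (leaves l) (leaves r)))
    collapse-rl : leaves r′ ++ leaves l′ ≡ collapse (leaves r ++ leaves l)
    collapse-rl = trans (cong₂ _++_ eqʳ eqˡ) (sym (collapse-++ (leaves r) (leaves l)))
    u∈ : u ∈ leaves l ++ leaves r
    u∈ = subst (u ∈_) (sym eq) (∈-++⁺ʳ ps (here refl))
    v∈ : v ∈ leaves l ++ leaves r
    v∈ = subst (v ∈_) (sym eq) (∈-++⁺ʳ ps (there (here refl)))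
    admissible′ : Admissible Γ/uv (node l′ r′)
    admissible′ =
      subst (IsOrdering Γ/uv) (sym collapse-lr) (Unique-collapse _ un , collapse-covers _ all∈) ,
      IsTubeP-collapse (leaves l ++ leaves r) (sym collapse-lr) tube (λ _ → u∈) , tubesˡ′ , tubesʳ′
    length′ : length (leaves l′ ++ leaves r′) ≡ m
    length′ = trans (cong length collapse-lr) (suc-injective (trans (length-collapse _ un v∈) len))

  swapChildren : ∀ n → SwapChildren n
  swapChildren zero Γ _≟_ l r _ len = ⊥-elim (leaves≢[] Γ l (++-conicalˡ (leaves l) (leaves r) (length-0 len)))
    where
    length-0 : ∀ {xs : List (V Γ)} → length xs ≡ 0 → xs ≡ []
    length-0 {[]} _ = refl
  swapChildren (suc m) Γ _≟_ (leaf x) (leaf y) ((((x≢y ∷ []) ∷ _) , all∈) , tube , _) _ =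
    Move-transposition Γ _≟_ x y all∈ (IsTubeP-pair⇒Adj Γ x≢y tube) ◅ ε
  swapChildren (suc m) Γ _≟_ (node l₁ l₂) r adm@((un , _) , _ , tubesˡ , tubesʳ) len
    with adjacentPair-node Γ l₁ l₂ tubesˡ (Unique-++⁻ˡ (leaves l₁ ++ leaves l₂) un)
  ... | adjacentPair ps qs u v eq u~v =
    swapChildren-collapse m (swapChildren m) Γ _≟_ (node l₁ l₂) r adm len u~v
      (collapseTree (node l₁ l₂) tubesˡ (Unique-++⁻ˡ ls un) ps qs eq)
      (mapTree π r , AllTubes-mapTree-π r tubesʳ v∉r , sym (collapse-leaves r v∉r))
      ps (qs ++ rs) (rs ++ ps) qs
      (trans (cong (_++ rs) eq) (++-assoc ps _ rs)) (trans (cong (rs ++_) eq) (sym (++-assoc rs ps _)))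
    where
    open EdgeContraction Γ _≟_ u v u~v
    ls : List (V Γ)
    ls = leaves l₁ ++ leaves l₂
    rs : List (V Γ)
    rs = leaves r
    v∉r : v ∉ rs
    v∉r = Unique-++-disjoint ls un (subst (v ∈_) (sym eq) (∈-++⁺ʳ ps (there (here refl))))
  swapChildren (suc m) Γ _≟_ (leaf x) (node r₁ r₂) adm@((un , _) , _ , tubesˡ , tubesʳ) len
    with adjacentPair-node Γ r₁ r₂ tubesʳ (Unique-++⁻ʳ (x ∷ []) un)
  ... | adjacentPair ps qs u v eq u~v =
    swapChildren-collapse m (swapChildren m) Γ _≟_ (leaf x) (node r₁ r₂) adm len u~v
      (mapTree π (leaf x) , AllTubes-mapTree-π (leaf x) tubesˡ v∉l , sym (collapse-leaves (leaf x) v∉l))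
      (collapseTree (node r₁ r₂) tubesʳ (Unique-++⁻ʳ (x ∷ []) un) ps qs eq)
      (x ∷ ps) qs ps (qs ++ x ∷ [])
      (cong (x ∷_) eq) (trans (cong (_++ x ∷ []) eq) (++-assoc ps _ (x ∷ [])))
    where
    open EdgeContraction Γ _≟_ u v u~v
    v∉l : v ∉ x ∷ []
    v∉l v∈ = Unique-++-disjoint (x ∷ []) un v∈ (subst (v ∈_) (sym eq) (∈-++⁺ʳ ps (there (here refl))))

  RotationMoves : ℕ → Set (lsuc lzero ⊔ c)
  RotationMoves n = ∀ Γ (_≟_ : DecidableEquality (V Γ)) {ω ω′} xs ys → PlanEq Γ ω → PlanEq Γ ω′ →
                    length ω ≡ n → ω ≡ xs ++ ys → ω′ ≡ ys ++ xs → Moves Γ ω ω′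

  rotationMoves-collapse : ∀ m → RotationMoves m → ∀ Γ (_≟_ : DecidableEquality (V Γ)) {ω ω′} xs ys →
    PlanEq Γ ω → PlanEq Γ ω′ → length ω ≡ suc m → ω ≡ xs ++ ys → ω′ ≡ ys ++ xs →
    ∀ {u v} (u~v : Adj Γ u v) ps qs ps′ qs′ → ω ≡ ps ++ u ∷ v ∷ qs → ω′ ≡ ps′ ++ u ∷ v ∷ qs′ → Moves Γ ω ω′
  rotationMoves-collapse m rotate Γ _≟_ {ω} {ω′} xs ys ω-plan ω′-plan len eq eq′ {u} {v} u~v ps qs ps′ qs′ split split′ =
    Moves-uncollapse Γ _≟_ u~v ps qs ps′ qs′ split split′ (PlanEq⇒Unique ω-plan) (PlanEq⇒Unique ω′-plan)
      (rotate Γ/uv _≟′_ (collapse xs) (collapse ys)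
        (PlanEq-collapse ω ω-plan ps qs split) (PlanEq-collapse ω′ ω′-plan ps′ qs′ split′)
        (suc-injective (trans (length-collapse ω (PlanEq⇒Unique ω-plan) v∈ω) len))
        (trans (cong collapse eq) (collapse-++ xs ys)) (trans (cong collapse eq′) (collapse-++ ys xs)))
    where
    open EdgeContraction Γ _≟_ u v u~v
    v∈ω : v ∈ ω
    v∈ω = subst (v ∈_) (sym split) (∈-++⁺ʳ ps (there (here refl)))

  -- Here ω = v ⋯ u; swapping the children of the root of ω makes u v consecutive.
  rotationMoves-straddle : ∀ m → RotationMoves m → ∀ Γ (_≟_ : DecidableEquality (V Γ)) {ω ω′} xs ys →
    PlanEq Γ ω → PlanEq Γ ω′ → length ω ≡ suc m → ω ≡ xs ++ ys → ω′ ≡ ys ++ xs →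
    ∀ {u v} (u~v : Adj Γ u v) ps qs → ω′ ≡ ps ++ u ∷ v ∷ qs → ys ≡ ps ++ u ∷ [] → xs ≡ v ∷ qs → Moves Γ ω ω′
  rotationMoves-straddle m rotate Γ _≟_ xs ys (leaf z , _ , eqz) _ _ refl _ {u} u~v ps qs _ refl refl
    with () ← ++-conicalʳ ps (u ∷ []) (++-conicalʳ qs (ps ++ u ∷ []) (sym (proj₂ (∷-injective eqz))))
  rotationMoves-straddle m rotate Γ _≟_ {ω′ = ω′} xs ys (node l r , adm , refl) ω′-plan len eq eq′ {u} {v} u~v ps qs split eqy eqx =
    swapChildren (suc m) Γ _≟_ l r adm len ◅◅
    rotationMoves-collapse m rotate Γ _≟_ as bs (node r l , Admissible-swap l r adm , refl) ω′-plan
      (trans (length-++-comm (leaves r) (leaves l)) len) eqa eqb u~v rs′ ls′ ps qs swapped split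
    where
    lr≡v∷ : leaves l ++ leaves r ≡ v ∷ (qs ++ ps) ++ u ∷ []
    lr≡v∷ = trans eq (trans (cong₂ _++_ eqx eqy) (cong (v ∷_) (sym (++-assoc qs ps (u ∷ [])))))
    ls′ rs′ : List (V Γ)
    ls′ = proj₁ (++-head (leaves l) (leaves r) (leaves≢[] Γ l) lr≡v∷)
    rs′ = proj₁ (++-last (leaves l) (leaves r) (v ∷ qs ++ ps) (leaves≢[] Γ r) lr≡v∷)
    swapped : leaves r ++ leaves l ≡ rs′ ++ u ∷ v ∷ ls′
    swapped = trans (cong₂ _++_ (proj₂ (++-last (leaves l) (leaves r) (v ∷ qs ++ ps) (leaves≢[] Γ r) lr≡v∷))
                                (proj₂ (++-head (leaves l) (leaves r) (leaves≢[] Γ l) lr≡v∷)))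
                    (++-assoc rs′ (u ∷ []) (v ∷ ls′))
    rotated : leaves r ++ leaves l ⟲ ys ++ xs
    rotated = ⟲-trans (leaves r , leaves l , refl , refl) (xs , ys , eq , refl)
    as bs : List (V Γ)
    as = proj₁ rotated
    bs = proj₁ (proj₂ rotated)
    eqa : leaves r ++ leaves l ≡ as ++ bs
    eqa = proj₁ (proj₂ (proj₂ rotated))
    eqb : ω′ ≡ bs ++ as
    eqb = trans eq′ (proj₂ (proj₂ (proj₂ rotated)))

  -- Induction on the number of vertices: an adjacent pair of leaves of the tree of ω′ is either
  -- consecutive in ω as well, or straddles the cut between the two halves.
  rotationMoves : ∀ n → RotationMoves n
  rotationMoves n Γ _≟_ [] ys _ _ _ refl refl = subst (Moves Γ ys) (sym (++-identityʳ ys)) ε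
  rotationMoves n Γ _≟_ (x ∷ xs) [] _ _ _ refl refl = subst (λ zs → Moves Γ zs (x ∷ xs)) (sym (++-identityʳ (x ∷ xs))) ε
  rotationMoves zero Γ _≟_ (x ∷ xs) (y ∷ ys) _ _ () refl refl
  rotationMoves (suc m) Γ _≟_ (x ∷ xs) (y ∷ ys) _ (leaf z , _ , eqz) _ refl refl
    with () ← ++-conicalʳ ys (x ∷ xs) (sym (proj₂ (∷-injective eqz)))
  rotationMoves (suc m) Γ _≟_ (x ∷ xs) (y ∷ ys) ω-plan ω′-plan@(node l′ r′ , ((un′ , _) , tubes′) , eq′) len refl refl
    with adjacentPair-node Γ l′ r′ tubes′ un′
  ... | adjacentPair ps qs u v split u~v with pairPosition (y ∷ ys) (x ∷ xs) ps qs u v (trans (sym eq′) split)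
  ... | inLeft qs₁ eqy =
    rotationMoves-collapse m (rotationMoves m) Γ _≟_ (x ∷ xs) (y ∷ ys) ω-plan ω′-plan len refl refl u~v
      ((x ∷ xs) ++ ps) qs₁ ps qs (trans (cong ((x ∷ xs) ++_) eqy) (sym (++-assoc (x ∷ xs) ps _))) (trans (sym eq′) split)
  ... | inRight ps₁ eqx =
    rotationMoves-collapse m (rotationMoves m) Γ _≟_ (x ∷ xs) (y ∷ ys) ω-plan ω′-plan len refl refl u~v
      ps₁ (qs ++ y ∷ ys) ps qs (trans (cong (_++ y ∷ ys) eqx) (++-assoc ps₁ _ (y ∷ ys))) (trans (sym eq′) split)
  ... | straddle eqy eqx =
    rotationMoves-straddle m (rotationMoves m) Γ _≟_ (x ∷ xs) (y ∷ ys) ω-plan ω′-plan len refl refl u~v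
      ps qs (trans (sym eq′) split) eqy eqx

  PlanEq-rotation⇒Moves : ∀ Γ (_≟_ : DecidableEquality (V Γ)) {ω ω′} → PlanEq Γ ω → PlanEq Γ ω′ → ω ⟲ ω′ → Moves Γ ω ω′
  PlanEq-rotation⇒Moves Γ _≟_ {ω} ω-plan ω′-plan (xs , ys , eq , eq′) =
    rotationMoves (length ω) Γ _≟_ xs ys ω-plan ω′-plan refl eq eq′

  Gen⇒rotationPair : ∀ {Γ x} → Gen K Γ x → ∃₂ λ ω ω′ → x ≡ (1# , ω) ∷ (- 1# , ω′) ∷ [] × ω ⟲ ω′
  Gen⇒rotationPair gen-r = _ , _ , refl , (fzero ∷ [] , fsuc fzero ∷ [] , refl , refl)
  Gen⇒rotationPair {Γ} (gen-iso {Δ} φ g) with Gen⇒rotationPair g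
  ... | _ , _ , refl , (as , bs , refl , refl) =
    _ , _ , refl , (map h as , map h bs , map-++ h as bs , map-++ h bs as)
    where
    h : V Δ → V Γ
    h = Inverse.to (Iso.bij φ)
  Gen⇒rotationPair {Γ} (gen-act G _ g p _) with Gen⇒rotationPair g
  ... | _ , _ , refl , (as , bs , refl , refl) =
    _ , _ , refl , (substOrd Γ G as p , substOrd Γ G bs p , substOrd-++ Γ G as bs p , substOrd-++ Γ G bs as p)

module Coefficients {c ℓ : Level} (K : Field c ℓ) (Γ : Graph) (_≟_ : DecidableEquality (V Γ)) where
  open Field K using (Carrier; _≈_; _+_; _*_; -_; 0#; 1#; setoid; ring; +-commutativeSemigroup;
    +-cong; +-congˡ; +-congʳ; +-assoc; +-comm; +-identityˡ; +-identityʳ; -‿inverseʳ; -‿cong;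
    *-congˡ; *-identityʳ; zeroʳ; distribˡ)
    renaming (refl to ≈-refl; sym to ≈-sym; trans to ≈-trans)
  open import Algebra.Properties.Ring ring using (-0#≈0#; -‿distribʳ-*)
  open import Algebra.Properties.CommutativeSemigroup +-commutativeSemigroup using (interchange; x∙yz≈y∙xz)
  open import Relation.Binary.Reasoning.Setoid setoid
  open Coeffs K Γ _≟_
  open Moves K
  open DecMembership (≡-dec _≟_) using (_∈?_)

  Ordering : Set
  Ordering = List (V Γ)

  _≟ₒ_ : DecidableEquality Ordering
  _≟ₒ_ = ≡-dec _≟_

  comb : List (Carrier × FS K Γ) → FS K Γ
  comb = combine K {Γ}

  ind : ∀ {P : Set} → Dec P → Carrier → Carrier
  ind (yes _) a = a
  ind (no _)  _ = 0#

  ind-cong : ∀ {P : Set} (d : Dec P) {a b} → a ≈ b → ind d a ≈ ind d b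
  ind-cong (yes _) a≈b = a≈b
  ind-cong (no _)  _   = ≈-refl

  ind-+ : ∀ {P : Set} (d : Dec P) a b → ind d (a + b) ≈ ind d a + ind d b
  ind-+ (yes _) a b = ≈-refl
  ind-+ (no _)  a b = ≈-sym (+-identityˡ 0#)

  ind-⇔ : ∀ {P Q : Set} (d : Dec P) (d′ : Dec Q) → (P → Q) → (Q → P) → ∀ a → ind d a ≈ ind d′ a
  ind-⇔ (yes _) (yes _) _   _   a = ≈-refl
  ind-⇔ (no _)  (no _)  _   _   a = ≈-refl
  ind-⇔ (yes p) (no ¬q) P⇒Q _   a = ⊥-elim (¬q (P⇒Q p))
  ind-⇔ (no ¬p) (yes q) _   Q⇒P a = ⊥-elim (¬p (Q⇒P q))

  ind-neg : ∀ {P : Set} (d : Dec P) a → ind d (- a) ≈ - ind d a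
  ind-neg (yes _) a = ≈-refl
  ind-neg (no _)  a = ≈-sym -0#≈0#

  ind-yes : ∀ {P : Set} → P → (d : Dec P) → ∀ a → ind d a ≈ a
  ind-yes p (yes _) a = ≈-refl
  ind-yes p (no ¬p) a = ⊥-elim (¬p p)

  ind-no : ∀ {P : Set} → ¬ P → (d : Dec P) → ∀ a → ind d a ≈ 0#
  ind-no ¬p (yes p) a = ⊥-elim (¬p p)
  ind-no ¬p (no _)  a = ≈-refl

  coeff-∷ : ∀ a l x w → coeff ((a , l) ∷ x) w ≈ ind (l ≟ₒ w) a + coeff x w
  coeff-∷ a l x w with l ≟ₒ w
  ... | yes _ = ≈-refl
  ... | no _  = ≈-sym (+-identityˡ _)

  cycCoeff-∷ : ∀ a l x w → cycCoeff ((a , l) ∷ x) w ≈ ind (l ∈? rotations w) a + cycCoeff x w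
  cycCoeff-∷ a l x w with l ∈? rotations w
  ... | yes _ = ≈-refl
  ... | no _  = ≈-sym (+-identityˡ _)

  rotate-++ : ∀ (as bs : Ordering) → rot (length as) (as ++ bs) ≡ bs ++ as
  rotate-++ as bs = cong₂ _++_ (drop-length as bs) (take-length as bs)
    where
    drop-length : ∀ (as bs : Ordering) → drop (length as) (as ++ bs) ≡ bs
    drop-length []       bs = refl
    drop-length (a ∷ as) bs = drop-length as bs
    take-length : ∀ (as bs : Ordering) → take (length as) (as ++ bs) ≡ as
    take-length []       bs = refl
    take-length (a ∷ as) bs = cong (a ∷_) (take-length as bs)

  ⟲⇒∈-rotations : ∀ {w l} → w ⟲ l → l ∈ rotations w
  ⟲⇒∈-rotations (as , bs , refl , refl) =
    subst (_∈ rotations (as ++ bs)) (rotate-++ as bs)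
      (∈-map⁺ (λ i → rot i (as ++ bs)) (∈-upTo⁺ (s≤s (length-++-≤ˡ as))))

  Rotation⇒⟲ : ∀ {w l : Ordering} → Rotation w l → w ⟲ l
  Rotation⇒⟲ {w} (i , eq) = take i w , drop i w , sym (take++drop≡id i w) , eq

  ∈-rotations⇒⟲ : ∀ {w l} → l ∈ rotations w → w ⟲ l
  ∈-rotations⇒⟲ {w} l∈ with ∈-map⁻ (λ i → rot i w) {xs = upTo (suc (length w))} l∈
  ... | i , _ , eq = Rotation⇒⟲ (i , eq)

  ∈-rotations-⟲ : ∀ {w l l′} → l ⟲ l′ → l ∈ rotations w → l′ ∈ rotations w
  ∈-rotations-⟲ l⟲l′ l∈ = ⟲⇒∈-rotations (⟲-trans (∈-rotations⇒⟲ l∈) l⟲l′)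

  surjective : Surjective
  surjective []      []                                    = [] , [] , λ _ → ≈-refl
  surjective ((a , l) ∷ y) ((l′ , rotation , l′-plan) ∷ y-cyc) with surjective y y-cyc
  ... | x , x-plan , x≈y = (a , l′) ∷ x , l′-plan ∷ x-plan , λ w → begin
    cycCoeff ((a , l′) ∷ x) w                      ≈⟨ cycCoeff-∷ a l′ x w ⟩
    ind (l′ ∈? rotations w) a + cycCoeff x w        ≈⟨ +-cong (ind-⇔ (l′ ∈? rotations w) (l ∈? rotations w)
                                                                  (∈-rotations-⟲ (⟲-sym l⟲l′)) (∈-rotations-⟲ l⟲l′) a)
                                                          (x≈y w) ⟩
    ind (l ∈? rotations w) a + cycCoeff y w         ≈⟨ cycCoeff-∷ a l y w ⟨
    cycCoeff ((a , l) ∷ y) w                        ∎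
    where
    l⟲l′ : l ⟲ l′
    l⟲l′ = Rotation⇒⟲ rotation

  record _∼_ (x y : FS K Γ) : Set (lsuc lzero ⊔ c ⊔ ℓ) where
    field
      gens     : List (Carrier × FS K Γ)
      gens-Gen : All (λ e → Gen K Γ (proj₂ e)) gens
      coeff-eq : ∀ w → coeff x w ≈ coeff y w + coeff (comb gens) w

  coeff-++ : ∀ x y w → coeff (x ++ y) w ≈ coeff x w + coeff y w
  coeff-++ []            y w = ≈-sym (+-identityˡ _)
  coeff-++ ((a , l) ∷ x) y w = begin
    coeff ((a , l) ∷ x ++ y) w                   ≈⟨ coeff-∷ a l (x ++ y) w ⟩
    ind (l ≟ₒ w) a + coeff (x ++ y) w            ≈⟨ +-congˡ (coeff-++ x y w) ⟩
    ind (l ≟ₒ w) a + (coeff x w + coeff y w)     ≈⟨ +-assoc _ _ _ ⟨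
    (ind (l ≟ₒ w) a + coeff x w) + coeff y w     ≈⟨ +-congʳ (coeff-∷ a l x w) ⟨
    coeff ((a , l) ∷ x) w + coeff y w            ∎

  ≈F⇒∼ : ∀ {x y} → x ≈F y → x ∼ y
  ≈F⇒∼ x≈y = record { gens = [] ; gens-Gen = [] ; coeff-eq = λ w → ≈-trans (x≈y w) (≈-sym (+-identityʳ _)) }

  ∼-refl : ∀ {x} → x ∼ x
  ∼-refl = ≈F⇒∼ (λ _ → ≈-refl)

  ∼-trans : ∀ {x y z} → x ∼ y → y ∼ z → x ∼ z
  ∼-trans {x} {y} {z} x∼y y∼z = record
    { gens     = Y.gens ++ X.gens
    ; gens-Gen = All.++⁺ Y.gens-Gen X.gens-Gen
    ; coeff-eq = λ w → begin
        coeff x w                                                       ≈⟨ X.coeff-eq w ⟩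
        coeff y w + coeff (comb X.gens) w                          ≈⟨ +-congʳ (Y.coeff-eq w) ⟩
        (coeff z w + coeff (comb Y.gens) w) + coeff (comb X.gens) w ≈⟨ +-assoc _ _ _ ⟩
        coeff z w + (coeff (comb Y.gens) w + coeff (comb X.gens) w) ≈⟨ +-congˡ (coeff-++ (comb Y.gens) _ w) ⟨
        coeff z w + coeff (comb Y.gens ++ comb X.gens) w      ≡⟨ cong (λ gs → coeff z w + coeff gs w) (concatMap-++ _ Y.gens X.gens) ⟨
        coeff z w + coeff (comb (Y.gens ++ X.gens)) w              ∎
    }
    where
    module X = _∼_ x∼y
    module Y = _∼_ y∼z

  ∼-cons : ∀ {x y} a l → x ∼ y → ((a , l) ∷ x) ∼ ((a , l) ∷ y)
  ∼-cons {x} {y} a l x∼y = record { gens = gens ; gens-Gen = gens-Gen ; coeff-eq = λ w → begin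
    coeff ((a , l) ∷ x) w                                          ≈⟨ coeff-∷ a l x w ⟩
    ind (l ≟ₒ w) a + coeff x w                                     ≈⟨ +-congˡ (coeff-eq w) ⟩
    ind (l ≟ₒ w) a + (coeff y w + coeff (comb gens) w)        ≈⟨ +-assoc _ _ _ ⟨
    (ind (l ≟ₒ w) a + coeff y w) + coeff (comb gens) w        ≈⟨ +-congʳ (coeff-∷ a l y w) ⟨
    coeff ((a , l) ∷ y) w + coeff (comb gens) w               ∎ }
    where open _∼_ x∼y

  open import Relation.Binary.Reasoning.Base.Single _∼_ ∼-refl ∼-trans
    using (step-∼) renaming (begin_ to ∼-begin_; _∎ to _∼∎)

  coeff-∷∷ : ∀ a l b l′ y w → coeff ((a , l) ∷ (b , l′) ∷ y) w ≈ ind (l ≟ₒ w) a + (ind (l′ ≟ₒ w) b + coeff y w)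
  coeff-∷∷ a l b l′ y w = ≈-trans (coeff-∷ a l _ w) (+-congˡ (coeff-∷ b l′ y w))

  ∼-swap : ∀ a l b l′ y → ((a , l) ∷ (b , l′) ∷ y) ∼ ((b , l′) ∷ (a , l) ∷ y)
  ∼-swap a l b l′ y = ≈F⇒∼ λ w → begin
    coeff ((a , l) ∷ (b , l′) ∷ y) w                  ≈⟨ coeff-∷∷ a l b l′ y w ⟩
    ind (l ≟ₒ w) a + (ind (l′ ≟ₒ w) b + coeff y w)    ≈⟨ x∙yz≈y∙xz _ _ _ ⟩
    ind (l′ ≟ₒ w) b + (ind (l ≟ₒ w) a + coeff y w)    ≈⟨ coeff-∷∷ b l′ a l y w ⟨
    coeff ((b , l′) ∷ (a , l) ∷ y) w                  ∎

  ∼-merge : ∀ a b l y → ((a , l) ∷ (b , l) ∷ y) ∼ ((a + b , l) ∷ y)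
  ∼-merge a b l y = ≈F⇒∼ λ w → begin
    coeff ((a , l) ∷ (b , l) ∷ y) w                   ≈⟨ coeff-∷∷ a l b l y w ⟩
    ind (l ≟ₒ w) a + (ind (l ≟ₒ w) b + coeff y w)     ≈⟨ +-assoc _ _ _ ⟨
    (ind (l ≟ₒ w) a + ind (l ≟ₒ w) b) + coeff y w     ≈⟨ +-congʳ (ind-+ (l ≟ₒ w) a b) ⟨
    ind (l ≟ₒ w) (a + b) + coeff y w                  ≈⟨ coeff-∷ (a + b) l y w ⟨
    coeff ((a + b , l) ∷ y) w                         ∎

  ∼-coeff : ∀ {a a′} l y → a ≈ a′ → ((a , l) ∷ y) ∼ ((a′ , l) ∷ y)
  ∼-coeff {a} {a′} l y a≈a′ = ≈F⇒∼ λ w →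
    ≈-trans (coeff-∷ a l y w) (≈-trans (+-congʳ (ind-cong (l ≟ₒ w) a≈a′)) (≈-sym (coeff-∷ a′ l y w)))

  ∼-drop : ∀ {a} l y → a ≈ 0# → ((a , l) ∷ y) ∼ y
  ∼-drop {a} l y a≈0 = ≈F⇒∼ λ w →
    ≈-trans (coeff-∷ a l y w) (≈-trans (+-congʳ (ind-0 (l ≟ₒ w))) (+-identityˡ _))
    where
    ind-0 : ∀ {P : Set} (d : Dec P) → ind d a ≈ 0#
    ind-0 (yes _) = a≈0
    ind-0 (no _)  = ≈-refl

  *-1≈- : ∀ a → a * - 1# ≈ - a
  *-1≈- a = ≈-trans (≈-sym (-‿distribʳ-* a 1#)) (-‿cong (*-identityʳ a))

  Move⇒∼ : ∀ {l l′} → Move Γ l l′ → ∀ b y → ((b , l) ∷ y) ∼ ((b , l′) ∷ y)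
  Move⇒∼ {l} {l′} move b y = record { gens = (b , _) ∷ [] ; gens-Gen = move ∷ [] ; coeff-eq = λ w →
    let A = ind (l ≟ₒ w) b ; B = ind (l′ ≟ₒ w) b ; Y = coeff y w in begin
    coeff ((b , l) ∷ y) w                       ≈⟨ coeff-∷ b l y w ⟩
    A + Y                                       ≈⟨ +-comm A Y ⟩
    Y + A                                       ≈⟨ +-identityˡ _ ⟨
    0# + (Y + A)                                ≈⟨ +-congʳ (-‿inverseʳ B) ⟨
    (B + - B) + (Y + A)                         ≈⟨ interchange B (- B) Y A ⟩
    (B + Y) + (- B + A)                         ≈⟨ +-congˡ (+-comm (- B) A) ⟩
    (B + Y) + (A + - B)                         ≈⟨ +-cong (coeff-∷ b l′ y w) (generator w) ⟨
    coeff ((b , l′) ∷ y) w + coeff (comb ((b , (1# , l) ∷ (- 1# , l′) ∷ []) ∷ [])) w ∎ }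
    where
    generator : ∀ w → coeff (comb ((b , (1# , l) ∷ (- 1# , l′) ∷ []) ∷ [])) w ≈ ind (l ≟ₒ w) b + - ind (l′ ≟ₒ w) b
    generator w = ≈-trans (coeff-∷∷ (b * 1#) l (b * - 1#) l′ [] w)
      (+-cong (ind-cong (l ≟ₒ w) (*-identityʳ b))
              (≈-trans (+-identityʳ _) (≈-trans (ind-cong (l′ ≟ₒ w) (*-1≈- b)) (ind-neg (l′ ≟ₒ w) b))))

  Moves⇒∼ : ∀ {l l′} → Moves Γ l l′ → ∀ b y → ((b , l) ∷ y) ∼ ((b , l′) ∷ y)
  Moves⇒∼ ε             b y = ∼-refl
  Moves⇒∼ (move ◅ moves) b y = ∼-trans (Move⇒∼ move b y) (Moves⇒∼ moves b y)

  outsideRotations : Ordering → FS K Γ → FS K Γ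
  outsideRotations ω []            = []
  outsideRotations ω ((b , l) ∷ x) with l ∈? rotations ω
  ... | yes _ = outsideRotations ω x
  ... | no _  = (b , l) ∷ outsideRotations ω x

  length-outsideRotations : ∀ ω x → length (outsideRotations ω x) ≤ length x
  length-outsideRotations ω []            = z≤n
  length-outsideRotations ω ((b , l) ∷ x) with l ∈? rotations ω
  ... | yes _ = m≤n⇒m≤1+n (length-outsideRotations ω x)
  ... | no _  = s≤s (length-outsideRotations ω x)

  InF-outsideRotations : ∀ ω x → InF K Γ x → InF K Γ (outsideRotations ω x)
  InF-outsideRotations ω []            []               = []
  InF-outsideRotations ω ((b , l) ∷ x) (l-plan ∷ x-plan) with l ∈? rotations ω
  ... | yes _ = InF-outsideRotations ω x x-plan
  ... | no _  = l-plan ∷ InF-outsideRotations ω x x-plan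

  -- The terms of x on rotations of ω are moved onto ω (they are planar, so moves connect them)
  -- and merged into the leading term.
  gather : ∀ ω → PlanEq Γ ω → ∀ x → InF K Γ x → ∀ a →
           ((a , ω) ∷ x) ∼ ((a + cycCoeff x ω , ω) ∷ outsideRotations ω x)
  gather ω ω-plan []            []               a = ∼-coeff ω [] (≈-sym (+-identityʳ a))
  gather ω ω-plan ((b , l) ∷ x) (l-plan ∷ x-plan) a with l ∈? rotations ω
  ... | yes l∈ = ∼-begin
    (a , ω) ∷ (b , l) ∷ x                                  ∼⟨ ∼-cons a ω (Moves⇒∼ moves b x) ⟩
    (a , ω) ∷ (b , ω) ∷ x                                  ∼⟨ ∼-merge a b ω x ⟩
    (a + b , ω) ∷ x                                        ∼⟨ gather ω ω-plan x x-plan (a + b) ⟩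
    ((a + b) + cycCoeff x ω , ω) ∷ outsideRotations ω x    ∼⟨ ∼-coeff ω _ (+-assoc a b _) ⟩
    (a + (b + cycCoeff x ω) , ω) ∷ outsideRotations ω x    ∼∎
    where
    moves : Moves Γ l ω
    moves = PlanEq-rotation⇒Moves Γ _≟_ l-plan ω-plan (⟲-sym (∈-rotations⇒⟲ l∈))
  ... | no _ = ∼-begin
    (a , ω) ∷ (b , l) ∷ x                                  ∼⟨ ∼-swap a ω b l x ⟩
    (b , l) ∷ (a , ω) ∷ x                                  ∼⟨ ∼-cons b l (gather ω ω-plan x x-plan a) ⟩
    (b , l) ∷ (a + cycCoeff x ω , ω) ∷ outsideRotations ω x ∼⟨ ∼-swap b l _ ω _ ⟩
    (a + cycCoeff x ω , ω) ∷ (b , l) ∷ outsideRotations ω x ∼∎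

  cycCoeff-self : ∀ a ω x → cycCoeff ((a , ω) ∷ x) ω ≈ a + cycCoeff x ω
  cycCoeff-self a ω x = ≈-trans (cycCoeff-∷ a ω x ω) (+-congʳ (ind-yes (⟲⇒∈-rotations (⟲-refl ω)) (ω ∈? rotations ω) a))

  cycCoeff-++ : ∀ x y w → cycCoeff (x ++ y) w ≈ cycCoeff x w + cycCoeff y w
  cycCoeff-++ []            y w = ≈-sym (+-identityˡ _)
  cycCoeff-++ ((a , l) ∷ x) y w = begin
    cycCoeff ((a , l) ∷ x ++ y) w                           ≈⟨ cycCoeff-∷ a l (x ++ y) w ⟩
    ind (l ∈? rotations w) a + cycCoeff (x ++ y) w          ≈⟨ +-congˡ (cycCoeff-++ x y w) ⟩
    ind (l ∈? rotations w) a + (cycCoeff x w + cycCoeff y w) ≈⟨ +-assoc _ _ _ ⟨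
    (ind (l ∈? rotations w) a + cycCoeff x w) + cycCoeff y w ≈⟨ +-congʳ (cycCoeff-∷ a l x w) ⟨
    cycCoeff ((a , l) ∷ x) w + cycCoeff y w                 ∎

  cycCoeff-scaleFS : ∀ a x w → cycCoeff (scaleFS K {Γ} a x) w ≈ a * cycCoeff x w
  cycCoeff-scaleFS a []            w = ≈-sym (zeroʳ a)
  cycCoeff-scaleFS a ((b , l) ∷ x) w = begin
    cycCoeff (scaleFS K {Γ} a ((b , l) ∷ x)) w                        ≈⟨ cycCoeff-∷ (a * b) l _ w ⟩
    ind (l ∈? rotations w) (a * b) + cycCoeff (scaleFS K {Γ} a x) w   ≈⟨ +-cong (ind-*ˡ (l ∈? rotations w)) (cycCoeff-scaleFS a x w) ⟩
    a * ind (l ∈? rotations w) b + a * cycCoeff x w               ≈⟨ distribˡ a _ _ ⟨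
    a * (ind (l ∈? rotations w) b + cycCoeff x w)                 ≈⟨ *-congˡ (cycCoeff-∷ b l x w) ⟨
    a * cycCoeff ((b , l) ∷ x) w                                  ∎
    where
    ind-*ˡ : ∀ {P : Set} (d : Dec P) → ind d (a * b) ≈ a * ind d b
    ind-*ˡ (yes _) = ≈-refl
    ind-*ˡ (no _)  = ≈-sym (zeroʳ a)

  cycCoeff-Gen : ∀ {g} → Gen K Γ g → ∀ w → cycCoeff g w ≈ 0#
  cycCoeff-Gen g-gen w with Gen⇒rotationPair g-gen
  ... | l , l′ , refl , l⟲l′ = begin
    cycCoeff ((1# , l) ∷ (- 1# , l′) ∷ []) w                             ≈⟨ ≈-trans (cycCoeff-∷ 1# l _ w)
                                                                              (+-congˡ (cycCoeff-∷ (- 1#) l′ [] w)) ⟩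
    ind (l ∈? rotations w) 1# + (ind (l′ ∈? rotations w) (- 1#) + 0#)    ≈⟨ +-congˡ (+-identityʳ _) ⟩
    ind (l ∈? rotations w) 1# + ind (l′ ∈? rotations w) (- 1#)           ≈⟨ +-congˡ (ind-⇔ (l′ ∈? rotations w) (l ∈? rotations w)
                                                                              (∈-rotations-⟲ (⟲-sym l⟲l′)) (∈-rotations-⟲ l⟲l′) (- 1#)) ⟩
    ind (l ∈? rotations w) 1# + ind (l ∈? rotations w) (- 1#)            ≈⟨ +-congˡ (ind-neg (l ∈? rotations w) 1#) ⟩
    ind (l ∈? rotations w) 1# + - ind (l ∈? rotations w) 1#              ≈⟨ -‿inverseʳ _ ⟩
    0#                                                                    ∎

  cycCoeff-comb : ∀ gs → All (λ e → Gen K Γ (proj₂ e)) gs → ∀ w → cycCoeff (comb gs) w ≈ 0#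
  cycCoeff-comb []             []               w = ≈-refl
  cycCoeff-comb ((a , g) ∷ gs) (g-gen ∷ gs-gen) w = begin
    cycCoeff (scaleFS K {Γ} a g ++ comb gs) w              ≈⟨ cycCoeff-++ (scaleFS K {Γ} a g) _ w ⟩
    cycCoeff (scaleFS K {Γ} a g) w + cycCoeff (comb gs) w  ≈⟨ +-cong (cycCoeff-scaleFS a g w) (cycCoeff-comb gs gs-gen w) ⟩
    a * cycCoeff g w + 0#                              ≈⟨ +-identityʳ _ ⟩
    a * cycCoeff g w                                   ≈⟨ *-congˡ (cycCoeff-Gen g-gen w) ⟩
    a * 0#                                             ≈⟨ zeroʳ a ⟩
    0#                                                 ∎

  sumOver : List Ordering → (Ordering → Carrier) → Carrier
  sumOver []       f = 0#
  sumOver (r ∷ rs) f = f r + sumOver rs f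

  sumOver-cong : ∀ rs {f g} → (∀ r → f r ≈ g r) → sumOver rs f ≈ sumOver rs g
  sumOver-cong []       f≈g = ≈-refl
  sumOver-cong (r ∷ rs) f≈g = +-cong (f≈g r) (sumOver-cong rs f≈g)

  sumOver-0 : ∀ rs → sumOver rs (λ _ → 0#) ≈ 0#
  sumOver-0 []       = ≈-refl
  sumOver-0 (r ∷ rs) = ≈-trans (+-identityˡ _) (sumOver-0 rs)

  sumOver-+ : ∀ rs f g → sumOver rs (λ r → f r + g r) ≈ sumOver rs f + sumOver rs g
  sumOver-+ []       f g = ≈-sym (+-identityˡ 0#)
  sumOver-+ (r ∷ rs) f g = ≈-trans (+-congˡ (sumOver-+ rs f g)) (interchange _ _ _ _)

  sumOver-ind : ∀ l a rs → Unique rs → (l∈? : Dec (l ∈ rs)) → sumOver rs (λ r → ind (l ≟ₒ r) a) ≈ ind l∈? a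
  sumOver-ind l a []       _          l∈? = ≈-sym (ind-no (λ ()) l∈? a)
  sumOver-ind l a (r ∷ rs) (r∉ ∷ un) l∈? with l ≟ₒ r
  ... | yes refl = begin
    a + sumOver rs (λ r → ind (l ≟ₒ r) a)  ≈⟨ +-congˡ (sumOver-ind l a rs un (l ∈? rs)) ⟩
    a + ind (l ∈? rs) a                    ≈⟨ +-congˡ (ind-no (λ l∈ → All.lookup r∉ l∈ refl) (l ∈? rs) a) ⟩
    a + 0#                                 ≈⟨ +-identityʳ a ⟩
    a                                      ≈⟨ ind-yes (here refl) l∈? a ⟨
    ind l∈? a                              ∎
  ... | no l≢r = begin
    0# + sumOver rs (λ r → ind (l ≟ₒ r) a) ≈⟨ +-identityˡ _ ⟩
    sumOver rs (λ r → ind (l ≟ₒ r) a)      ≈⟨ sumOver-ind l a rs un (l ∈? rs) ⟩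
    ind (l ∈? rs) a                        ≈⟨ ind-⇔ (l ∈? rs) l∈? there (λ { (here l≡r) → ⊥-elim (l≢r l≡r) ; (there l∈) → l∈ }) a ⟩
    ind l∈? a                              ∎

  -- rotations w may list a rotation several times; cycCoeff counts each ordering once.
  distinctRotations : Ordering → List Ordering
  distinctRotations w = deduplicate _≟ₒ_ (rotations w)

  cycCoeff≈sumOver : ∀ x w → cycCoeff x w ≈ sumOver (distinctRotations w) (coeff x)
  cycCoeff≈sumOver []            w = ≈-sym (sumOver-0 (distinctRotations w))
  cycCoeff≈sumOver ((a , l) ∷ x) w = begin
    cycCoeff ((a , l) ∷ x) w                                  ≈⟨ cycCoeff-∷ a l x w ⟩
    ind (l ∈? rotations w) a + cycCoeff x w                   ≈⟨ +-cong (ind-⇔ (l ∈? rotations w) (l ∈? R) (∈-deduplicate⁺ _≟ₒ_)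
                                                                             (∈-deduplicate⁻ _≟ₒ_ (rotations w)) a)
                                                                         (cycCoeff≈sumOver x w) ⟩
    ind (l ∈? R) a + sumOver R (coeff x)                      ≈⟨ +-congʳ (sumOver-ind l a R (DecUnique.deduplicate-! _≟ₒ_ (rotations w)) (l ∈? R)) ⟨
    sumOver R (λ r → ind (l ≟ₒ r) a) + sumOver R (coeff x)   ≈⟨ sumOver-+ R _ _ ⟨
    sumOver R (λ r → ind (l ≟ₒ r) a + coeff x r)             ≈⟨ sumOver-cong R (coeff-∷ a l x) ⟨
    sumOver R (coeff ((a , l) ∷ x))                           ∎
    where
    R : List Ordering
    R = distinctRotations w

  ∼⇒cycCoeff≈ : ∀ {x y} → x ∼ y → ∀ w → cycCoeff x w ≈ cycCoeff y w
  ∼⇒cycCoeff≈ {x} {y} x∼y w = begin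
    cycCoeff x w                                          ≈⟨ cycCoeff≈sumOver x w ⟩
    sumOver R (coeff x)                                   ≈⟨ sumOver-cong R coeff-eq ⟩
    sumOver R (λ r → coeff y r + coeff (comb gens) r)     ≈⟨ sumOver-+ R _ _ ⟩
    sumOver R (coeff y) + sumOver R (coeff (comb gens))   ≈⟨ +-cong (cycCoeff≈sumOver y w) (cycCoeff≈sumOver (comb gens) w) ⟨
    cycCoeff y w + cycCoeff (comb gens) w                 ≈⟨ +-congˡ (cycCoeff-comb gens gens-Gen w) ⟩
    cycCoeff y w + 0#                                     ≈⟨ +-identityʳ _ ⟩
    cycCoeff y w                                          ∎
    where
    open _∼_ x∼y
    R : List Ordering
    R = distinctRotations w

  kernel⇒∼[] : ∀ n x → length x ≤ n → InF K Γ x → InKernel x → x ∼ []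
  kernel⇒∼[] _       []            _         _                 _   = ∼-refl
  kernel⇒∼[] (suc n) ((a , ω) ∷ x) (s≤s len) (ω-plan ∷ x-plan) ker =
    ∼-trans x∼rest (kernel⇒∼[] n rest (≤-trans (length-outsideRotations ω x) len) (InF-outsideRotations ω x x-plan)
                      (λ w → ≈-trans (≈-sym (∼⇒cycCoeff≈ x∼rest w)) (ker w)))
    where
    rest : FS K Γ
    rest = outsideRotations ω x
    x∼rest : ((a , ω) ∷ x) ∼ rest
    x∼rest = ∼-trans (gather ω ω-plan x x-plan a) (∼-drop ω rest (≈-trans (≈-sym (cycCoeff-self a ω x)) (ker ω)))

  kernel⇔submodule : ∀ x → InF K Γ x → InKernel x ⇔ InSubmodule x
  kernel⇔submodule x x-plan = mk⇔ kernel⇒submodule submodule⇒kernel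
    where
    kernel⇒submodule : InKernel x → InSubmodule x
    kernel⇒submodule ker = gens , gens-Gen , λ w → ≈-trans (coeff-eq w) (+-identityˡ _)
      where open _∼_ (kernel⇒∼[] (length x) x ≤-refl x-plan ker)
    submodule⇒kernel : InSubmodule x → InKernel x
    submodule⇒kernel (gs , gs-Gen , x≈gs) = ∼⇒cycCoeff≈ x∼[]
      where
      x∼[] : x ∼ []
      x∼[] = record { gens = gs ; gens-Gen = gs-Gen ; coeff-eq = λ w → ≈-trans (x≈gs w) (≈-sym (+-identityˡ _)) }

theorem3p3p2 : ∀ {c ℓ : Level} (K : Field c ℓ) (Γ : Graph) (fin : Finite Γ) →
    Connected Γ →
    let open Coeffs K Γ (finDecEq Γ fin) in
    Surjective × (∀ x → InF K Γ x → (InKernel x ⇔ InSubmodule x))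
theorem3p3p2 K Γ fin _ = surjective , kernel⇔submodule
  where open Coefficients K Γ (finDecEq Γ fin)
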